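{- For every integer $n\ge1$, \[o_1(n)=\begin{cases}o_3(n)&\text{if } n \text{ is odd},\\ o_3(n)+q(n/2)&\text{if } n \text{ is even}.\end{cases}\]
   Context: The mex of a partition is the smallest positive integer that is not a part of it. The following counts are used: - $o_1(n)$ is the number of partitions of $n$ whose mex is congruent to $1 \bmod 4$; - $o_3(n)$ is the number of partitions of $n$ whose mex is congruent to $3 \bmod 4$; - $q(k)$ is the number of partitions of $k$ into distinct parts. -}

module Defs where

open import Data.Nat using (ℕ; zero; suc; _+_; _∸_; _≤ᵇ_; _≡ᵇ_; _%_; _<ᵇ_)
open import Data.Bool using (Bool; true; false; if_then_else_; _∧_; _∨_; not)
open import Data.List using (List; []; _∷_; _++_; map; filter; length)
open import Relation.Binary.PropositionalEquality using (_≡_)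
open import Data.Nat.Properties using (_≟_)

-- A partition is represented as a non-increasing list of positive integers.
-- partsFuel f n m : all partitions of n with every part ≤ m (listed once each),
-- valid whenever the fuel f ≥ n.
partsFuel : ℕ → ℕ → ℕ → List (List ℕ)
partsFuel zero    n zero    = if n ≡ᵇ 0 then ([] ∷ []) else []
partsFuel zero    n (suc m) = if n ≡ᵇ 0 then ([] ∷ []) else []
partsFuel (suc f) n zero    = if n ≡ᵇ 0 then ([] ∷ []) else []
partsFuel (suc f) n (suc m) =
  partsFuel (suc f) n m
  ++ (if suc m ≤ᵇ n then map (suc m ∷_) (partsFuel f (n ∸ suc m) (suc m)) else [])

partitions : ℕ → List (List ℕ)
partitions n = partsFuel n n n

elem : ℕ → List ℕ → Bool
elem k []       = false
elem k (x ∷ xs) = (k ≡ᵇ x) ∨ elem k xs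

mexFrom : ℕ → ℕ → List ℕ → ℕ
mexFrom zero    k p = k
mexFrom (suc f) k p = if elem k p then mexFrom f (suc k) p else k

mex : List ℕ → ℕ
mex p = mexFrom (suc (length p)) 1 p

-- all parts distinct (partition lists are non-increasing, so strictly decreasing)
distinct : List ℕ → Bool
distinct []           = true
distinct (x ∷ [])     = true
distinct (x ∷ y ∷ xs) = (y <ᵇ x) ∧ distinct (y ∷ xs)

count : (List ℕ → Bool) → List (List ℕ) → ℕ
count P []       = 0
count P (x ∷ xs) = if P x then suc (count P xs) else count P xs

o₁ : ℕ → ℕ
o₁ n = count (λ p → mex p % 4 ≡ᵇ 1) (partitions n)

o₃ : ℕ → ℕ
o₃ n = count (λ p → mex p % 4 ≡ᵇ 3) (partitions n)

q : ℕ → ℕ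
q k = count distinct (partitions k)

-- Weighting each partition λ by χ(mex λ), where χ(r) = [r ≡ 1] - [r ≡ 3] (mod 4), gives the series
-- ∑ₙ (o₁(n) - o₃(n)) Xⁿ. Since χ(r) = ∑_{j<r} ε_j with ε = +, -, -, +, … (period 4), and the
-- partitions containing 1, …, j have generating function X^(T_j) / (X;X)_∞ with T_j = j(j+1)/2,
-- this series is ψ / (X;X)_∞ for ψ = ∑_j ε_j X^(T_j). The Jacobi triple product in base X⁴ gives
-- ψ = (X;X⁴)_∞ (X³;X⁴)_∞ (X⁴;X⁴)_∞ = (X;X)_∞ (-X²;X²)_∞, so the series is (-X²;X²)_∞ = ∑ₘ q(m) X^(2m).
--
-- Everything is done with finite products, comparing coefficients up to X^N. The triple product is
-- used in the finite form ∑_k (-1)^k X^(k(2k+1)) [2n choose n+k]_{X⁴} = (X;X⁴)_n (X³;X⁴)_n, and for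
-- n = 2N + 1 every term reaching X^N has (X⁴;X⁴)_{2n} [2n choose n+k]_{X⁴} ≡ 1 modulo X^(N+1).

module Submission where

open import Defs
open import Data.Nat
  using (ℕ; zero; suc; _+_; _*_; _∸_; _≤_; _<_; _%_; z≤n; s≤s; _≤ᵇ_; _≡ᵇ_)
import Data.Nat as ℕ
open import Data.Nat.DivMod using (_/_; [m+n]%n≡m%n; m≡m%n+[m/n]*n)
open import Data.Nat.Properties
  using (+-comm; ≤-trans; ≤-refl; n≤1+n; m≤n+m; m∸n+n≡m; +-∸-assoc; ≰⇒>)
import Data.Nat.Properties as ℕP
import Data.Nat.Tactic.RingSolver as ℕSolver
open import Data.Integer using (ℤ; +_; 0ℤ; 1ℤ; -1ℤ)
  renaming (_+_ to _+ᶻ_; _*_ to _*ᶻ_; -_ to -ᶻ_; _-_ to _-ᶻ_)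
import Data.Integer.Properties as ℤP
open import Algebra.Properties.AbelianGroup ℤP.+-0-abelianGroup
  using () renaming (∙-cancelʳ to +ᶻ-cancelʳ)
open import Data.Integer.Tactic.RingSolver using (solve-∀)
open import Data.Bool using (Bool; true; false; if_then_else_; _∧_; T)
open import Data.Bool.Properties using (∧-identityʳ; ∧-zeroʳ; T-≡)
open import Data.Empty using (⊥-elim)
open import Data.Fin using (Fin; toℕ)
import Data.Fin.Properties as FinP
open import Data.List using (List; []; _∷_; _++_; map; length; lookup)
open import Data.List.Properties using (++-identityʳ)
open import Data.List.Membership.Propositional using (_∈_)
open import Data.List.Relation.Unary.All using (All; []; _∷_)
import Data.List.Relation.Unary.All as All
import Data.List.Relation.Unary.All.Properties as All
open import Data.List.Relation.Unary.Any using (here; there)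
import Data.List.Relation.Unary.Any as Any
open import Data.List.Relation.Unary.Any.Properties using (lookup-index)
open import Data.Product using (_×_; _,_; proj₁; proj₂)
open import Data.Sum using (inj₁; inj₂)
open import Function using (_∘_; Equivalence)
open import Relation.Nullary using (yes; no; ¬_)
open import Relation.Binary.PropositionalEquality
  using (_≡_; _≢_; _≗_; refl; sym; trans; cong; cong₂; subst; module ≡-Reasoning)

sumBelow : ℕ → (ℕ → ℤ) → ℤ
sumBelow zero    F = 0ℤ
sumBelow (suc K) F = sumBelow K F +ᶻ F K

syntax sumBelow K (λ r → e) = ∑[ r < K ] e

∑-cong : ∀ K {F G : ℕ → ℤ} → (∀ r → r < K → F r ≡ G r) →
         ∑[ r < K ] F r ≡ ∑[ r < K ] G r
∑-cong zero    eq = refl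
∑-cong (suc K) eq =
  cong₂ _+ᶻ_ (∑-cong K (λ r r<K → eq r (≤-trans r<K (n≤1+n K)))) (eq K ≤-refl)

∑-distrib-+ : ∀ K (F G : ℕ → ℤ) →
              ∑[ r < K ] (F r +ᶻ G r) ≡ ∑[ r < K ] F r +ᶻ ∑[ r < K ] G r
∑-distrib-+ zero    F G = refl
∑-distrib-+ (suc K) F G =
  trans (cong (_+ᶻ (F K +ᶻ G K)) (∑-distrib-+ K F G))
        (swap (∑[ r < K ] F r) (∑[ r < K ] G r) (F K) (G K))
  where
  swap : ∀ a b c d → a +ᶻ b +ᶻ (c +ᶻ d) ≡ a +ᶻ c +ᶻ (b +ᶻ d)
  swap = solve-∀

∑-distribˡ-* : ∀ K c (F : ℕ → ℤ) → ∑[ r < K ] (c *ᶻ F r) ≡ c *ᶻ ∑[ r < K ] F r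
∑-distribˡ-* zero    c F = sym (ℤP.*-zeroʳ c)
∑-distribˡ-* (suc K) c F =
  trans (cong (_+ᶻ c *ᶻ F K) (∑-distribˡ-* K c F)) (sym (ℤP.*-distribˡ-+ c _ (F K)))

∑-sucˡ : ∀ K (F : ℕ → ℤ) → ∑[ r < suc K ] F r ≡ F 0 +ᶻ ∑[ r < K ] F (suc r)
∑-sucˡ zero    F = trans (ℤP.+-identityˡ (F 0)) (sym (ℤP.+-identityʳ (F 0)))
∑-sucˡ (suc K) F = trans (cong (_+ᶻ F (suc K)) (∑-sucˡ K F)) (ℤP.+-assoc (F 0) _ (F (suc K)))

∑-truncate : ∀ {K r} (F : ℕ → ℤ) → r ≤ K → (∀ j → r ≤ j → F j ≡ 0ℤ) →
             ∑[ j < K ] F j ≡ ∑[ j < r ] F j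
∑-truncate {K} {r} F r≤K vanish =
  trans (cong (λ k → ∑[ j < k ] F j) (sym (m∸n+n≡m r≤K))) (drop (K ∸ r))
  where
  drop : ∀ d → ∑[ j < d + r ] F j ≡ ∑[ j < r ] F j
  drop zero    = refl
  drop (suc d) = trans (cong₂ _+ᶻ_ (drop d) (vanish (d + r) (m≤n+m r d))) (ℤP.+-identityʳ _)

-- Formal power series

Series : Set
Series = ℕ → ℤ

𝟘 𝟙 : Series
𝟘 _ = 0ℤ
𝟙 zero    = 1ℤ
𝟙 (suc _) = 0ℤ

infixl 6 _⊕_
infixr 7 _⊛_

_⊕_ : Series → Series → Series
(f ⊕ g) t = f t +ᶻ g t

_⊛_ : ℤ → Series → Series
(c ⊛ f) t = c *ᶻ f t

sumSeries : ℕ → (ℕ → Series) → Series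
sumSeries K F t = ∑[ r < K ] F r t

syntax sumSeries K (λ r → f) = ∑ˢ[ r < K ] f

shift : ℕ → Series → Series
shift zero    f         = f
shift (suc a) f zero    = 0ℤ
shift (suc a) f (suc t) = shift a f t

monomial : ℤ → ℕ → Series → Series
monomial c a f = c ⊛ shift a f

factor : ℤ → ℕ → Series → Series
factor c a f = f ⊕ monomial c a f

record Linear (T : Series → Series) : Set where
  field
    cong-≗ : ∀ {f g} → f ≗ g → T f ≗ T g
    ⊕-homo : ∀ f g → T (f ⊕ g) ≗ T f ⊕ T g
    ⊛-homo : ∀ c f → T (c ⊛ f) ≗ c ⊛ T f

  𝟘-homo : T 𝟘 ≗ 𝟘
  -- 𝟘 and 0ℤ ⊛ 𝟘 agree by computation.
  𝟘-homo t = trans (cong-≗ (λ _ → refl) t) (trans (⊛-homo 0ℤ 𝟘 t) (ℤP.*-zeroˡ (T 𝟘 t)))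

  vanishing : ∀ {f} → f ≗ 𝟘 → T f ≗ 𝟘
  vanishing eq t = trans (cong-≗ eq t) (𝟘-homo t)

  ∑-homo : ∀ K (F : ℕ → Series) → T (∑ˢ[ r < K ] F r) ≗ ∑ˢ[ r < K ] T (F r)
  ∑-homo zero    F = 𝟘-homo
  ∑-homo (suc K) F t =
    trans (⊕-homo (∑ˢ[ r < K ] F r) (F K) t) (cong (_+ᶻ T (F K) t) (∑-homo K F t))

ShiftInvariant : (Series → Series) → Set
ShiftInvariant T = ∀ a f → T (shift a f) ≗ shift a (T f)

∘-linear : ∀ {T U} → Linear T → Linear U → Linear (T ∘ U)
∘-linear LT LU = record
  { cong-≗ = λ eq → T.cong-≗ (U.cong-≗ eq)
  ; ⊕-homo = λ f g t → trans (T.cong-≗ (U.⊕-homo f g) t) (T.⊕-homo _ _ t)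
  ; ⊛-homo = λ c f t → trans (T.cong-≗ (U.⊛-homo c f) t) (T.⊛-homo c _ t)
  }
  where module T = Linear LT; module U = Linear LU

∘-shiftInvariant : ∀ {T U} → Linear T → ShiftInvariant T → ShiftInvariant U →
                   ShiftInvariant (T ∘ U)
∘-shiftInvariant LT IT IU a f t = trans (Linear.cong-≗ LT (IU a f) t) (IT a _ t)

shift-cong : ∀ a {f g} → f ≗ g → shift a f ≗ shift a g
shift-cong zero    eq t       = eq t
shift-cong (suc a) eq zero    = refl
shift-cong (suc a) eq (suc t) = shift-cong a eq t

shift-linear : ∀ a → Linear (shift a)
shift-linear a = record { cong-≗ = shift-cong a ; ⊕-homo = ⊕-homo a ; ⊛-homo = ⊛-homo a }
  where
  ⊕-homo : ∀ a f g → shift a (f ⊕ g) ≗ shift a f ⊕ shift a g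
  ⊕-homo zero    f g t       = refl
  ⊕-homo (suc a) f g zero    = refl
  ⊕-homo (suc a) f g (suc t) = ⊕-homo a f g t
  ⊛-homo : ∀ a c f → shift a (c ⊛ f) ≗ c ⊛ shift a f
  ⊛-homo zero    c f t       = refl
  ⊛-homo (suc a) c f zero    = sym (ℤP.*-zeroʳ c)
  ⊛-homo (suc a) c f (suc t) = ⊛-homo a c f t

shift-shift : ∀ a b f → shift a (shift b f) ≗ shift (a + b) f
shift-shift zero    b f t       = refl
shift-shift (suc a) b f zero    = refl
shift-shift (suc a) b f (suc t) = shift-shift a b f t

shift-shiftInvariant : ∀ b → ShiftInvariant (shift b)
shift-shiftInvariant b a f t =
  trans (shift-shift b a f t)
        (trans (cong (λ e → shift e f t) (+-comm b a)) (sym (shift-shift a b f t)))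

shift-below : ∀ a f {t} → t < a → shift a f t ≡ 0ℤ
shift-below (suc a) f {zero}  _         = refl
shift-below (suc a) f {suc t} (s≤s t<a) = shift-below a f t<a

shift-if : ∀ a f t → shift a f t ≡ (if a ≤ᵇ t then f (t ∸ a) else 0ℤ)
shift-if zero          f t       = refl
shift-if (suc a)       f zero    = refl
shift-if (suc zero)    f (suc t) = refl
shift-if (suc (suc a)) f (suc t) = shift-if (suc a) f t

factor-linear : ∀ c a → Linear (factor c a)
factor-linear c a = record
  { cong-≗ = λ eq t → cong₂ (λ x y → x +ᶻ c *ᶻ y) (eq t) (S.cong-≗ eq t)
  ; ⊕-homo = λ f g t → trans (cong (λ y → f t +ᶻ g t +ᶻ c *ᶻ y) (S.⊕-homo f g t))
                             (ring-⊕ c (f t) (g t) _ _)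
  ; ⊛-homo = λ k f t → trans (cong (λ y → k *ᶻ f t +ᶻ c *ᶻ y) (S.⊛-homo k f t))
                             (ring-⊛ c k (f t) _)
  }
  where
  module S = Linear (shift-linear a)
  ring-⊕ : ∀ c x y z w → x +ᶻ y +ᶻ c *ᶻ (z +ᶻ w) ≡ x +ᶻ c *ᶻ z +ᶻ (y +ᶻ c *ᶻ w)
  ring-⊕ = solve-∀
  ring-⊛ : ∀ c k x y → k *ᶻ x +ᶻ c *ᶻ (k *ᶻ y) ≡ k *ᶻ (x +ᶻ c *ᶻ y)
  ring-⊛ = solve-∀

factor-commute : ∀ {T} → Linear T → ShiftInvariant T → ∀ c a f →
                 T (factor c a f) ≗ factor c a (T f)
factor-commute {T} LT IT c a f t =
  trans (T.⊕-homo f _ t) (cong (T f t +ᶻ_) (trans (T.⊛-homo c _ t) (cong (c *ᶻ_) (IT a f t))))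
  where module T = Linear LT

shift-factor : ∀ a c b f → shift a (factor c b f) ≗ factor c b (shift a f)
shift-factor a = factor-commute (shift-linear a) (shift-shiftInvariant a)

factor-shiftInvariant : ∀ c a → ShiftInvariant (factor c a)
factor-shiftInvariant c a b f t = sym (shift-factor b c a f t)

monomial-linear : ∀ c a → Linear (monomial c a)
monomial-linear c a = record
  { cong-≗ = λ eq t → cong (c *ᶻ_) (S.cong-≗ eq t)
  ; ⊕-homo = λ f g t → trans (cong (c *ᶻ_) (S.⊕-homo f g t)) (ℤP.*-distribˡ-+ c _ _)
  ; ⊛-homo = λ k f t → trans (cong (c *ᶻ_) (S.⊛-homo k f t)) (commute c k _)
  }
  where
  module S = Linear (shift-linear a)
  commute : ∀ c k x → c *ᶻ (k *ᶻ x) ≡ k *ᶻ (c *ᶻ x)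
  commute = solve-∀

monomial-shiftInvariant : ∀ c a → ShiftInvariant (monomial c a)
monomial-shiftInvariant c a b f t =
  trans (cong (c *ᶻ_) (shift-shiftInvariant a b f t)) (sym (Linear.⊛-homo (shift-linear b) c _ t))

Factor : Set
Factor = ℤ × ℕ

prod : List Factor → Series → Series
prod []            f = f
prod ((c , a) ∷ L) f = factor c a (prod L f)

prod-linear : ∀ L → Linear (prod L)
prod-linear []            =
  record { cong-≗ = λ eq → eq ; ⊕-homo = λ _ _ _ → refl ; ⊛-homo = λ _ _ _ → refl }
prod-linear ((c , a) ∷ L) = ∘-linear (factor-linear c a) (prod-linear L)

prod-shiftInvariant : ∀ L → ShiftInvariant (prod L)
prod-shiftInvariant []            a f t = refl
prod-shiftInvariant ((c , a) ∷ L) =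
  ∘-shiftInvariant (factor-linear c a) (factor-shiftInvariant c a) (prod-shiftInvariant L)

prod-commute : ∀ {T} → Linear T → ShiftInvariant T → ∀ L f → T (prod L f) ≗ prod L (T f)
prod-commute LT IT []            f t = refl
prod-commute LT IT ((c , a) ∷ L) f t =
  trans (factor-commute LT IT c a (prod L f) t)
        (Linear.cong-≗ (factor-linear c a) (prod-commute LT IT L f) t)

prod-++ : ∀ L M f → prod (L ++ M) f ≡ prod L (prod M f)
prod-++ []            M f = refl
prod-++ ((c , a) ∷ L) M f = cong (factor c a) (prod-++ L M f)

infix 4 _≈[_]_

_≈[_]_ : Series → ℕ → Series → Set
f ≈[ N ] g = ∀ t → t ≤ N → f t ≡ g t

≈-trans : ∀ {N f g h} → f ≈[ N ] g → g ≈[ N ] h → f ≈[ N ] h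
≈-trans p q t t≤N = trans (p t t≤N) (q t t≤N)

≗⇒≈ : ∀ {N f g} → f ≗ g → f ≈[ N ] g
≗⇒≈ eq t _ = eq t

shift-≈ : ∀ a {N f g} → f ≈[ N ] g → shift a f ≈[ N ] shift a g
shift-≈ zero    p                = p
shift-≈ (suc a) p zero    _      = refl
shift-≈ (suc a) {suc N} p (suc t) (s≤s t≤N) =
  shift-≈ a (λ u u≤N → p u (≤-trans u≤N (n≤1+n N))) t t≤N

monomial-≈ : ∀ c a {N f g} → f ≈[ N ] g → monomial c a f ≈[ N ] monomial c a g
monomial-≈ c a eq t t≤N = cong (c *ᶻ_) (shift-≈ a eq t t≤N)

factor-≈-id : ∀ c a {N} f → N < a → factor c a f ≈[ N ] f
factor-≈-id c a f N<a t t≤N =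
  trans (cong (λ y → f t +ᶻ c *ᶻ y) (shift-below a f (≤-trans (s≤s t≤N) N<a)))
        (trans (cong (f t +ᶻ_) (ℤP.*-zeroʳ c)) (ℤP.+-identityʳ (f t)))

AllExponents : (ℕ → Set) → List Factor → Set
AllExponents P = All (P ∘ proj₂)

prod-≈-id : ∀ L {N} f → AllExponents (N <_) L → prod L f ≈[ N ] f
prod-≈-id []            f []            = λ _ _ → refl
prod-≈-id ((c , a) ∷ L) f (N<a ∷ N<L) =
  ≈-trans (factor-≈-id c a (prod L f) N<a) (prod-≈-id L f N<L)

-- Coefficient t of (1 + c X^(1+a)) f determines f t once f is known below t.
factor-cancel : ∀ c a {N f g} → factor c (suc a) f ≈[ N ] factor c (suc a) g → f ≈[ N ] g
factor-cancel c a {N} {f} {g} p t t≤N = go t t ≤-refl t≤N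
  where
  go : ∀ M t → t ≤ M → t ≤ N → f t ≡ g t
  go M       zero    _         t≤N = trans (sym (coeff₀ f)) (trans (p zero t≤N) (coeff₀ g))
    where
    coeff₀ : ∀ h → factor c (suc a) h zero ≡ h zero
    coeff₀ h = trans (cong (h zero +ᶻ_) (ℤP.*-zeroʳ c)) (ℤP.+-identityʳ (h zero))
  go (suc M) (suc t) (s≤s t≤M) t≤N =
    +ᶻ-cancelʳ _ _ _ (trans (p (suc t) t≤N) (cong (λ y → g (suc t) +ᶻ c *ᶻ y) (sym lower)))
    where
    lower : shift a f t ≡ shift a g t
    lower = shift-≈ a (λ u u≤t → go M u (≤-trans u≤t t≤M) (≤-trans u≤t (≤-trans (n≤1+n t) t≤N)))
                      t ≤-refl

prod-cancel : ∀ L {N f g} → AllExponents (1 ≤_) L → prod L f ≈[ N ] prod L g → f ≈[ N ] g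
prod-cancel []                  []            p = p
prod-cancel ((c , suc a) ∷ L) (s≤s _ ∷ ps) p = prod-cancel L ps (factor-cancel c a p)

∑ˢ-≈ : ∀ {N} K {F G : ℕ → Series} → (∀ r → r < K → F r ≈[ N ] G r) →
       ∑ˢ[ r < K ] F r ≈[ N ] ∑ˢ[ r < K ] G r
∑ˢ-≈ K eq t t≤N = ∑-cong K (λ r r<K → eq r r<K t t≤N)

-- Gaussian binomials and a finite Jacobi triple product

-- gauss d m (1 + r) is the Gaussian binomial [m choose r] in the base q = X^d;
-- the index is shifted so that gauss d m 0 = 𝟘 plays the role of [m choose -1].
gauss : ℕ → ℕ → ℕ → Series
gauss d zero    zero          = 𝟘
gauss d zero    (suc zero)    = 𝟙
gauss d zero    (suc (suc r)) = 𝟘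
gauss d (suc m) zero          = 𝟘
gauss d (suc m) (suc r)       = gauss d m r ⊕ shift (r * d) (gauss d m (suc r))

gauss-zero : ∀ d m → gauss d m 0 ≗ 𝟘
gauss-zero d zero    t = refl
gauss-zero d (suc m) t = refl

gauss-one : ∀ d m → gauss d m 1 ≗ 𝟙
gauss-one d zero    t = refl
gauss-one d (suc m) t =
  trans (cong (_+ᶻ gauss d m 1 t) (gauss-zero d m t)) (trans (ℤP.+-identityˡ _) (gauss-one d m t))

gauss-vanish : ∀ d m r → suc m < r → gauss d m r ≗ 𝟘
gauss-vanish d zero    (suc zero)    (s≤s ())
gauss-vanish d zero    (suc (suc r)) _           t = refl
gauss-vanish d (suc m) (suc r)       (s≤s m<r) t =
  cong₂ _+ᶻ_ (gauss-vanish d m r m<r t)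
             (Linear.vanishing (shift-linear (r * d))
                               (gauss-vanish d m (suc r) (≤-trans m<r (n≤1+n r))) t)

factor-zero : ∀ f → factor -1ℤ 0 f ≗ 𝟘
factor-zero f t = cancel (f t)
  where
  cancel : ∀ x → x +ᶻ -1ℤ *ᶻ x ≡ 0ℤ
  cancel = solve-∀

factor-𝟘 : ∀ c a {f} → f ≗ 𝟘 → factor c a f ≗ 𝟘
factor-𝟘 c a = Linear.vanishing (factor-linear c a)

factor-telescope : ∀ a b f → factor -1ℤ a f ⊕ shift a (factor -1ℤ b f) ≗ factor -1ℤ (a + b) f
factor-telescope a b f t =
  trans (cong (factor -1ℤ a f t +ᶻ_)
          (trans (S.⊕-homo f _ t) (cong (shift a f t +ᶻ_) (trans (S.⊛-homo -1ℤ _ t)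
                                                         (cong (-1ℤ *ᶻ_) (shift-shift a b f t))))))
        (ring (f t) (shift a f t) (shift (a + b) f t))
  where
  module S = Linear (shift-linear a)
  ring : ∀ x y z → x +ᶻ -1ℤ *ᶻ y +ᶻ (y +ᶻ -1ℤ *ᶻ z) ≡ x +ᶻ -1ℤ *ᶻ z
  ring = solve-∀

gauss-ratio : ∀ d m r → factor -1ℤ (r * d) (gauss d m (suc r))
                       ≗ factor -1ℤ ((suc m ∸ r) * d) (gauss d m r)
gauss-ratio d zero zero t =
  trans (factor-zero 𝟙 t) (sym (factor-𝟘 -1ℤ (1 * d) (λ _ → refl) t))
gauss-ratio d zero (suc zero) t =
  trans (factor-𝟘 -1ℤ (1 * d) (λ _ → refl) t) (sym (factor-zero 𝟙 t))
gauss-ratio d zero (suc (suc r)) t =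
  trans (factor-𝟘 -1ℤ (suc (suc r) * d) (λ _ → refl) t)
        (sym (factor-𝟘 -1ℤ 0 (λ _ → refl) t))
gauss-ratio d (suc m) zero t =
  trans (factor-zero (gauss d (suc m) 1) t)
        (sym (factor-𝟘 -1ℤ (suc (suc m) * d) (λ _ → refl) t))
gauss-ratio d (suc m) (suc s) t = begin
  factor -1ℤ (r * d) (gauss d (suc m) (suc r)) t
    ≡⟨ F.⊕-homo (gauss d m r) _ t ⟩
  factor -1ℤ (r * d) (gauss d m r) t
    +ᶻ factor -1ℤ (r * d) (shift (r * d) (gauss d m (suc r))) t
    ≡⟨ cong (factor -1ℤ (r * d) (gauss d m r) t +ᶻ_)
         (trans (sym (shift-factor (r * d) -1ℤ (r * d) _ t))
                (shift-cong (r * d) (gauss-ratio d m r) t)) ⟩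
  factor -1ℤ (r * d) (gauss d m r) t
    +ᶻ shift (r * d) (factor -1ℤ ((suc m ∸ r) * d) (gauss d m r)) t
    ≡⟨ factor-telescope (r * d) _ (gauss d m r) t ⟩
  factor -1ℤ (r * d + (suc m ∸ r) * d) (gauss d m r) t
    ≡⟨ exponents ⟩
  factor -1ℤ (s * d + (suc m ∸ s) * d) (gauss d m r) t
    ≡⟨ sym (factor-telescope (s * d) _ (gauss d m r) t) ⟩
  factor -1ℤ (s * d) (gauss d m r) t
    +ᶻ shift (s * d) (factor -1ℤ ((suc m ∸ s) * d) (gauss d m r)) t
    ≡⟨ cong₂ _+ᶻ_ (gauss-ratio d m s t)
                  (shift-factor (s * d) -1ℤ ((suc m ∸ s) * d) (gauss d m r) t) ⟩
  factor -1ℤ ((suc m ∸ s) * d) (gauss d m s) t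
    +ᶻ factor -1ℤ ((suc m ∸ s) * d) (shift (s * d) (gauss d m r)) t
    ≡⟨ sym (F′.⊕-homo (gauss d m s) _ t) ⟩
  factor -1ℤ ((suc (suc m) ∸ r) * d) (gauss d (suc m) r) t ∎
  where
  open ≡-Reasoning
  r = suc s
  module F  = Linear (factor-linear -1ℤ (r * d))
  module F′ = Linear (factor-linear -1ℤ ((suc m ∸ s) * d))
  -- Both exponents equal (m + 1) d when s ≤ m; otherwise gauss d m r vanishes.
  exponents : factor -1ℤ (r * d + (suc m ∸ r) * d) (gauss d m r) t
            ≡ factor -1ℤ (s * d + (suc m ∸ s) * d) (gauss d m r) t
  exponents with s ℕ.≤? m
  ... | yes s≤m = cong (λ e → factor -1ℤ e (gauss d m r) t) (equal-exponents s≤m)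
    where
    equal-exponents : s ≤ m → r * d + (suc m ∸ r) * d ≡ s * d + (suc m ∸ s) * d
    equal-exponents s≤m rewrite +-∸-assoc 1 s≤m = ring s (m ∸ s) d
      where
      ring : ∀ a b d → suc a * d + b * d ≡ a * d + suc b * d
      ring = ℕSolver.solve-∀
  ... | no s≰m = trans (factor-𝟘 -1ℤ (r * d + (suc m ∸ r) * d) vanishes t)
                       (sym (factor-𝟘 -1ℤ (s * d + (suc m ∸ s) * d) vanishes t))
    where
    vanishes : gauss d m r ≗ 𝟘
    vanishes = gauss-vanish d m r (s≤s (≰⇒> s≰m))

gauss-pascal : ∀ d m r →
  gauss d (suc m) (suc r) ≗ shift ((suc m ∸ r) * d) (gauss d m r) ⊕ gauss d m (suc r)
gauss-pascal d m r t =
  rearrange (gauss d m r t) (gauss d m (suc r) t) _ _ (gauss-ratio d m r t)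
  where
  rearrange : ∀ A B u v → B +ᶻ -1ℤ *ᶻ u ≡ A +ᶻ -1ℤ *ᶻ v → A +ᶻ u ≡ v +ᶻ B
  rearrange A B u v e =
    trans (ring₁ A u v) (trans (cong (λ z → z +ᶻ u +ᶻ v) (sym e)) (ring₂ B u v))
    where
    ring₁ : ∀ A u v → A +ᶻ u ≡ A +ᶻ -1ℤ *ᶻ v +ᶻ u +ᶻ v
    ring₁ = solve-∀
    ring₂ : ∀ B u v → B +ᶻ -1ℤ *ᶻ u +ᶻ u +ᶻ v ≡ v +ᶻ B
    ring₂ = solve-∀

monomial-reindex : ∀ {c c′ a a′ e b} f → c′ ≡ -ᶻ c → a′ + e ≡ a + b →
                   monomial c′ a′ (shift e f) ≗ -1ℤ ⊛ shift b (monomial c a f)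
monomial-reindex {c} {a = a} {a′} {e} {b} f refl exps t = begin
  -ᶻ c *ᶻ shift a′ (shift e f) t
    ≡⟨ cong (-ᶻ c *ᶻ_) (shift-shift a′ e f t) ⟩
  -ᶻ c *ᶻ shift (a′ + e) f t
    ≡⟨ cong (λ x → -ᶻ c *ᶻ shift x f t) (trans exps (+-comm a b)) ⟩
  -ᶻ c *ᶻ shift (b + a) f t
    ≡⟨ ring c _ ⟩
  -1ℤ *ᶻ (c *ᶻ shift (b + a) f t)
    ≡⟨ cong (λ x → -1ℤ *ᶻ (c *ᶻ x)) (sym (shift-shift b a f t)) ⟩
  -1ℤ *ᶻ (c *ᶻ shift b (shift a f) t)
    ≡⟨ cong (-1ℤ *ᶻ_) (sym (Linear.⊛-homo (shift-linear b) c _ t)) ⟩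
  -1ℤ *ᶻ shift b (monomial c a f) t ∎
  where
  open ≡-Reasoning
  ring : ∀ c x → -ᶻ c *ᶻ x ≡ -1ℤ *ᶻ (c *ᶻ x)
  ring = solve-∀

triangular : ℕ → ℕ
triangular zero    = zero
triangular (suc j) = triangular j + suc j

sign : ℕ → ℤ
sign zero          = 1ℤ
sign (suc zero)    = -1ℤ
sign (suc (suc j)) = -ᶻ sign j

-- For k = r - h ∈ ℤ, jacobiIndex r h is the j with triangular j = k (2k + 1),
-- namely 2k for k ≥ 0 and -2k - 1 for k < 0; then sign j = (-1)^k.
jacobiIndex : ℕ → ℕ → ℕ
jacobiIndex zero    zero    = zero
jacobiIndex zero    (suc h) = suc (h * 2)
jacobiIndex (suc r) zero    = suc r * 2
jacobiIndex (suc r) (suc h) = jacobiIndex r h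

jacobiExp : ℕ → ℕ → ℕ
jacobiExp r h = triangular (jacobiIndex r h)

jacobiSign : ℕ → ℕ → ℤ
jacobiSign r h = sign (jacobiIndex r h)

jacobiTerm : ℕ → ℕ → Series → Series
jacobiTerm r h = monomial (jacobiSign r h) (jacobiExp r h)

jacobiSign-sucˡ : ∀ r h → jacobiSign (suc r) h ≡ -ᶻ jacobiSign r h
jacobiSign-sucˡ zero    zero          = refl
jacobiSign-sucˡ zero    (suc zero)    = refl
jacobiSign-sucˡ zero    (suc (suc h)) = sym (ℤP.neg-involutive _)
jacobiSign-sucˡ (suc r) zero          = refl
jacobiSign-sucˡ (suc r) (suc h)       = jacobiSign-sucˡ r h

jacobiSign-sucʳ : ∀ r h → jacobiSign r (suc h) ≡ -ᶻ jacobiSign r h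
jacobiSign-sucʳ r h = trans (sym (ℤP.neg-involutive _)) (cong -ᶻ_ (sym (jacobiSign-sucˡ r (suc h))))

-- (k + 1)(2k + 3) - k (2k + 1) = 4k + 3
jacobiExp-sucˡ : ∀ r h → jacobiExp (suc r) h + h * 4 ≡ jacobiExp r h + r * 4 + 3
jacobiExp-sucˡ zero zero                = refl
jacobiExp-sucˡ zero (suc zero)          = refl
jacobiExp-sucˡ zero (suc (suc h))       = ring (triangular (suc (h * 2))) h
  where
  ring : ∀ x h → x + suc (suc h) * 4 ≡ x + suc (suc (h * 2)) + suc (suc (suc (h * 2))) + 0 * 4 + 3
  ring = ℕSolver.solve-∀
jacobiExp-sucˡ (suc r) zero             = ring (triangular (suc r * 2)) r
  where
  ring : ∀ x r → x + suc (suc r * 2) + suc (suc (suc r * 2)) + 0 * 4 ≡ x + suc r * 4 + 3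
  ring = ℕSolver.solve-∀
jacobiExp-sucˡ (suc r) (suc h) =
  trans (ring₁ (jacobiExp (suc r) h) h)
        (trans (cong (_+ 4) (jacobiExp-sucˡ r h)) (ring₂ (jacobiExp r h) r))
  where
  ring₁ : ∀ a h → a + suc h * 4 ≡ a + h * 4 + 4
  ring₁ = ℕSolver.solve-∀
  ring₂ : ∀ b r → b + r * 4 + 3 + 4 ≡ b + suc r * 4 + 3
  ring₂ = ℕSolver.solve-∀

jacobiExp-sucʳ : ∀ r n → jacobiExp r (suc n) + r * 4 ≡ jacobiExp r n + suc (n * 4)
jacobiExp-sucʳ r n =
  ℕP.+-cancelʳ-≡ 3 _ _ (trans (sym (jacobiExp-sucˡ r (suc n))) (ring (jacobiExp r n) n))
  where
  ring : ∀ b n → b + suc n * 4 ≡ b + suc (n * 4) + 3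
  ring = ℕSolver.solve-∀

jacobiExp-pascal : ∀ r n → r ≤ n * 2 →
                   jacobiExp (suc r) n + (n * 2 ∸ r) * 4 ≡ jacobiExp r n + suc (suc (suc (n * 4)))
jacobiExp-pascal r n r≤2n = ℕP.+-cancelʳ-≡ (r * 4) _ _ (begin
  X + d * 4 + r * 4      ≡⟨ ring₁ X d r ⟩
  X + (d + r) * 4        ≡⟨ cong (λ z → X + z * 4) (m∸n+n≡m r≤2n) ⟩
  X + n * 2 * 4          ≡⟨ ring₂ X n ⟩
  X + n * 4 + n * 4      ≡⟨ cong (_+ n * 4) (jacobiExp-sucˡ r n) ⟩
  Y + r * 4 + 3 + n * 4  ≡⟨ ring₃ Y r n ⟩
  Y + suc (suc (suc (n * 4))) + r * 4 ∎)
  where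
  open ≡-Reasoning
  X = jacobiExp (suc r) n
  Y = jacobiExp r n
  d = n * 2 ∸ r
  ring₁ : ∀ X d r → X + d * 4 + r * 4 ≡ X + (d + r) * 4
  ring₁ = ℕSolver.solve-∀
  ring₂ : ∀ X n → X + n * 2 * 4 ≡ X + n * 4 + n * 4
  ring₂ = ℕSolver.solve-∀
  ring₃ : ∀ Y r n → Y + r * 4 + 3 + n * 4 ≡ Y + suc (suc (suc (n * 4))) + r * 4
  ring₃ = ℕSolver.solve-∀

jacobiTerm-linear : ∀ r h → Linear (jacobiTerm r h)
jacobiTerm-linear r h = monomial-linear (jacobiSign r h) (jacobiExp r h)

jacobiTerm-pascal : ∀ r n f → r ≤ n * 2 →
  jacobiTerm (suc r) n (shift ((n * 2 ∸ r) * 4) f)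
  ≗ -1ℤ ⊛ shift (suc (suc (suc (n * 4)))) (jacobiTerm r n f)
jacobiTerm-pascal r n f r≤2n =
  monomial-reindex {a = jacobiExp r n} {jacobiExp (suc r) n} {(n * 2 ∸ r) * 4} f
                   (jacobiSign-sucˡ r n) (jacobiExp-pascal r n r≤2n)

jacobiTerm-sucʳ : ∀ r n f →
  jacobiTerm r (suc n) (shift (r * 4) f) ≗ -1ℤ ⊛ shift (suc (n * 4)) (jacobiTerm r n f)
jacobiTerm-sucʳ r n f =
  monomial-reindex {a = jacobiExp r n} {jacobiExp r (suc n)} {r * 4} f
                   (jacobiSign-sucʳ r n) (jacobiExp-sucʳ r n)

jacobiSumEven : ℕ → Series
jacobiSumEven n = ∑ˢ[ r < suc (n * 2) ] jacobiTerm r n (gauss 4 (n * 2) (suc r))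

jacobiSumOdd : ℕ → Series
jacobiSumOdd n = ∑ˢ[ r < suc (suc (n * 2)) ] jacobiTerm r n (gauss 4 (suc (n * 2)) (suc r))

jacobiSumOdd-factor : ∀ n → jacobiSumOdd n ≗ factor -1ℤ (suc (suc (suc (n * 4)))) (jacobiSumEven n)
jacobiSumOdd-factor n t = begin
  jacobiSumOdd n t                         ≡⟨ ∑-cong (suc K) pascal ⟩
  ∑[ r < suc K ] (A r +ᶻ B r)              ≡⟨ ∑-distrib-+ (suc K) A B ⟩
  ∑[ r < suc K ] A r +ᶻ ∑[ r < suc K ] B r ≡⟨ cong₂ _+ᶻ_ sumA sumB ⟩
  jacobiSumEven n t +ᶻ -1ℤ *ᶻ shift e (jacobiSumEven n) t ∎
  where
  open ≡-Reasoning
  K = suc (n * 2)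
  e = suc (suc (suc (n * 4)))
  A B : ℕ → ℤ
  A r = jacobiTerm r n (gauss 4 (n * 2) (suc r)) t
  B r = jacobiTerm r n (shift ((K ∸ r) * 4) (gauss 4 (n * 2) r)) t
  pascal : ∀ r → r < suc K → jacobiTerm r n (gauss 4 K (suc r)) t ≡ A r +ᶻ B r
  pascal r _ = trans (Linear.cong-≗ (jacobiTerm-linear r n) (gauss-pascal 4 (n * 2) r) t)
                     (trans (Linear.⊕-homo (jacobiTerm-linear r n) _ _ t) (ℤP.+-comm (B r) (A r)))
  sumA : ∑[ r < suc K ] A r ≡ jacobiSumEven n t
  sumA = trans (cong (∑[ r < K ] A r +ᶻ_)
                 (Linear.vanishing (jacobiTerm-linear K n) (gauss-vanish 4 (n * 2) (suc K) ≤-refl) t))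
               (ℤP.+-identityʳ _)
  B₀ : B 0 ≡ 0ℤ
  B₀ = Linear.vanishing (∘-linear (jacobiTerm-linear 0 n) (shift-linear (K * 4)))
                        (gauss-zero 4 (n * 2)) t
  sumB : ∑[ r < suc K ] B r ≡ -1ℤ *ᶻ shift e (jacobiSumEven n) t
  sumB = begin
    ∑[ r < suc K ] B r
      ≡⟨ trans (∑-sucˡ K B)
               (trans (cong (_+ᶻ ∑[ r < K ] B (suc r)) B₀) (ℤP.+-identityˡ _)) ⟩
    ∑[ r < K ] B (suc r)
      ≡⟨ ∑-cong K (λ r r<K →
           jacobiTerm-pascal r n (gauss 4 (n * 2) (suc r)) (ℕP.≤-pred r<K) t) ⟩
    ∑[ r < K ] (-1ℤ *ᶻ shift e (jacobiTerm r n (gauss 4 (n * 2) (suc r))) t)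
      ≡⟨ ∑-distribˡ-* K -1ℤ _ ⟩
    -1ℤ *ᶻ ∑[ r < K ] shift e (jacobiTerm r n (gauss 4 (n * 2) (suc r))) t
      ≡⟨ cong (-1ℤ *ᶻ_) (sym (Linear.∑-homo (shift-linear e) K _ t)) ⟩
    -1ℤ *ᶻ shift e (jacobiSumEven n) t ∎

jacobiSumEven-factor : ∀ n → jacobiSumEven (suc n) ≗ factor -1ℤ (suc (n * 4)) (jacobiSumOdd n)
jacobiSumEven-factor n t = begin
  jacobiSumEven (suc n) t                  ≡⟨ ∑-cong (suc K) pascal ⟩
  ∑[ r < suc K ] (A r +ᶻ B r)              ≡⟨ ∑-distrib-+ (suc K) A B ⟩
  ∑[ r < suc K ] A r +ᶻ ∑[ r < suc K ] B r ≡⟨ cong₂ _+ᶻ_ sumA sumB ⟩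
  jacobiSumOdd n t +ᶻ -1ℤ *ᶻ shift e (jacobiSumOdd n) t ∎
  where
  open ≡-Reasoning
  K = suc (suc (n * 2))
  e = suc (n * 4)
  A B : ℕ → ℤ
  A r = jacobiTerm r (suc n) (gauss 4 (suc (n * 2)) r) t
  B r = jacobiTerm r (suc n) (shift (r * 4) (gauss 4 (suc (n * 2)) (suc r))) t
  pascal : ∀ r → r < suc K → jacobiTerm r (suc n) (gauss 4 K (suc r)) t ≡ A r +ᶻ B r
  pascal r _ = Linear.⊕-homo (jacobiTerm-linear r (suc n)) _ _ t
  sumA : ∑[ r < suc K ] A r ≡ jacobiSumOdd n t
  sumA = trans (∑-sucˡ K A)
           (trans (cong (_+ᶻ ∑[ r < K ] A (suc r))
                    (Linear.vanishing (jacobiTerm-linear 0 (suc n)) (gauss-zero 4 (suc (n * 2))) t))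
                  (ℤP.+-identityˡ _))
  Bₖ : B K ≡ 0ℤ
  Bₖ = Linear.vanishing (∘-linear (jacobiTerm-linear K (suc n)) (shift-linear (K * 4)))
         (gauss-vanish 4 (suc (n * 2)) (suc K) ≤-refl) t
  sumB : ∑[ r < suc K ] B r ≡ -1ℤ *ᶻ shift e (jacobiSumOdd n) t
  sumB = begin
    ∑[ r < suc K ] B r
      ≡⟨ trans (cong (∑[ r < K ] B r +ᶻ_) Bₖ) (ℤP.+-identityʳ _) ⟩
    ∑[ r < K ] B r
      ≡⟨ ∑-cong K (λ r _ → jacobiTerm-sucʳ r n (gauss 4 (suc (n * 2)) (suc r)) t) ⟩
    ∑[ r < K ] (-1ℤ *ᶻ shift e (jacobiTerm r n (gauss 4 (suc (n * 2)) (suc r))) t)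
      ≡⟨ ∑-distribˡ-* K -1ℤ _ ⟩
    -1ℤ *ᶻ ∑[ r < K ] shift e (jacobiTerm r n (gauss 4 (suc (n * 2)) (suc r))) t
      ≡⟨ cong (-1ℤ *ᶻ_) (sym (Linear.∑-homo (shift-linear e) K _ t)) ⟩
    -1ℤ *ᶻ shift e (jacobiSumOdd n) t ∎

oddFactors : ℕ → List Factor
oddFactors zero    = []
oddFactors (suc n) = (-1ℤ , suc (n * 4)) ∷ (-1ℤ , suc (suc (suc (n * 4)))) ∷ oddFactors n

finite-jacobi : ∀ n → jacobiSumEven n ≗ prod (oddFactors n) 𝟙
finite-jacobi zero    t = trans (ℤP.+-identityˡ _) (ℤP.*-identityˡ (𝟙 t))
finite-jacobi (suc n) t =
  trans (jacobiSumEven-factor n t)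
        (Linear.cong-≗ (factor-linear -1ℤ (suc (n * 4))) (λ u →
          trans (jacobiSumOdd-factor n u)
                (Linear.cong-≗ (factor-linear -1ℤ (suc (suc (suc (n * 4))))) (finite-jacobi n) u))
          t)

-- (-X²;X²) as ψ / (X;X) up to X^N

factor-comm : ∀ c a d b f → factor c a (factor d b f) ≗ factor d b (factor c a f)
factor-comm c a = factor-commute (factor-linear c a) (factor-shiftInvariant c a)

factor-merge : ∀ a f → factor -1ℤ a (factor 1ℤ a f) ≗ factor -1ℤ (a + a) f
factor-merge a f t =
  trans (cong (λ y → f t +ᶻ 1ℤ *ᶻ shift a f t +ᶻ -1ℤ *ᶻ y)
          (trans (S.⊕-homo f _ t) (cong (shift a f t +ᶻ_) (trans (S.⊛-homo 1ℤ _ t)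
                                                           (cong (1ℤ *ᶻ_) (shift-shift a a f t))))))
        (ring (f t) (shift a f t) (shift (a + a) f t))
  where
  module S = Linear (shift-linear a)
  ring : ∀ x y z → x +ᶻ 1ℤ *ᶻ y +ᶻ -1ℤ *ᶻ (y +ᶻ 1ℤ *ᶻ z) ≡ x +ᶻ -1ℤ *ᶻ z
  ring = solve-∀

eulerFactors : ℕ → List Factor
eulerFactors zero    = []
eulerFactors (suc L) = (-1ℤ , suc L) ∷ eulerFactors L

distinctFactors : ℕ → ℕ → List Factor
distinctFactors d zero    = []
distinctFactors d (suc L) = (1ℤ , suc L * d) ∷ distinctFactors d L

quarticFactors : ℕ → ℕ → List Factor
quarticFactors s zero    = []
quarticFactors s (suc d) = (-1ℤ , (s + suc d) * 4) ∷ quarticFactors s d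

gaussNumerator : ℕ → ℕ → List Factor
gaussNumerator m zero    = []
gaussNumerator m (suc r) = (-1ℤ , (m ∸ r) * 4) ∷ gaussNumerator m r

six-factors : ∀ a₁ a₂ a₃ a₄ f →
  factor -1ℤ a₄ (factor -1ℤ a₃ (factor -1ℤ a₂ (factor -1ℤ a₁ (factor 1ℤ a₄ (factor 1ℤ a₂ f)))))
  ≗ factor -1ℤ (a₄ + a₄) (factor -1ℤ (a₂ + a₂) (factor -1ℤ a₁ (factor -1ℤ a₃ f)))
six-factors a₁ a₂ a₃ a₄ f t = begin
  F- a₄ (F- a₃ (F- a₂ (F- a₁ (F+ a₄ (F+ a₂ f))))) t
    ≡⟨ F-₄ (F-₃ (F-₂ (factor-comm -1ℤ a₁ 1ℤ a₄ (F+ a₂ f)))) t ⟩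
  F- a₄ (F- a₃ (F- a₂ (F+ a₄ (F- a₁ (F+ a₂ f))))) t
    ≡⟨ F-₄ (F-₃ (factor-comm -1ℤ a₂ 1ℤ a₄ (F- a₁ (F+ a₂ f)))) t ⟩
  F- a₄ (F- a₃ (F+ a₄ (F- a₂ (F- a₁ (F+ a₂ f))))) t
    ≡⟨ F-₄ (factor-comm -1ℤ a₃ 1ℤ a₄ (F- a₂ (F- a₁ (F+ a₂ f)))) t ⟩
  F- a₄ (F+ a₄ (F- a₃ (F- a₂ (F- a₁ (F+ a₂ f))))) t
    ≡⟨ factor-merge a₄ (F- a₃ (F- a₂ (F- a₁ (F+ a₂ f)))) t ⟩
  F- (a₄ + a₄) (F- a₃ (F- a₂ (F- a₁ (F+ a₂ f)))) t
    ≡⟨ F-₄₄ (F-₃ (F-₂ (factor-comm -1ℤ a₁ 1ℤ a₂ f))) t ⟩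
  F- (a₄ + a₄) (F- a₃ (F- a₂ (F+ a₂ (F- a₁ f)))) t
    ≡⟨ F-₄₄ (F-₃ (factor-merge a₂ (F- a₁ f))) t ⟩
  F- (a₄ + a₄) (F- a₃ (F- (a₂ + a₂) (F- a₁ f))) t
    ≡⟨ F-₄₄ (factor-comm -1ℤ a₃ -1ℤ (a₂ + a₂) (F- a₁ f)) t ⟩
  F- (a₄ + a₄) (F- (a₂ + a₂) (F- a₃ (F- a₁ f))) t
    ≡⟨ F-₄₄ (F-₂₂ (factor-comm -1ℤ a₃ -1ℤ a₁ f)) t ⟩
  F- (a₄ + a₄) (F- (a₂ + a₂) (F- a₁ (F- a₃ f))) t ∎
  where
  open ≡-Reasoning
  F- F+ : ℕ → Series → Series
  F- = factor -1ℤ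
  F+ = factor 1ℤ
  F-₂ = Linear.cong-≗ (factor-linear -1ℤ a₂)
  F-₃ = Linear.cong-≗ (factor-linear -1ℤ a₃)
  F-₄ = Linear.cong-≗ (factor-linear -1ℤ a₄)
  F-₂₂ = Linear.cong-≗ (factor-linear -1ℤ (a₂ + a₂))
  F-₄₄ = Linear.cong-≗ (factor-linear -1ℤ (a₄ + a₄))

prod-factor : ∀ L c a f → prod L (factor c a f) ≗ factor c a (prod L f)
prod-factor L = factor-commute (prod-linear L) (prod-shiftInvariant L)

euler-distinct : ∀ n f → prod (eulerFactors (n * 4)) (prod (distinctFactors 2 (n * 2)) f)
                         ≗ prod (quarticFactors 0 (n * 2)) (prod (oddFactors n) f)
euler-distinct zero    f t = refl
euler-distinct (suc n) f t = begin
  F- a₄ (F- a₃ (F- a₂ (F- a₁ (Euler (F+ b₂ (F+ b₁ (Distinct f))))))) t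
    ≡⟨ inner (λ u → trans (prod-factor (eulerFactors (n * 4)) 1ℤ b₂ _ u)
                   (F+b₂ (λ w → trans (prod-factor (eulerFactors (n * 4)) 1ℤ b₁ _ w)
                                      (F+b₁ (euler-distinct n f) w)) u)) ⟩
  F- a₄ (F- a₃ (F- a₂ (F- a₁ (F+ b₂ (F+ b₁ X))))) t
    ≡⟨ cong₂ (λ b b′ → F- a₄ (F- a₃ (F- a₂ (F- a₁ (F+ b (F+ b′ X))))) t) b₂≡a₄ b₁≡a₂ ⟩
  F- a₄ (F- a₃ (F- a₂ (F- a₁ (F+ a₄ (F+ a₂ X))))) t
    ≡⟨ six-factors a₁ a₂ a₃ a₄ X t ⟩
  F- (a₄ + a₄) (F- (a₂ + a₂) (F- a₁ (F- a₃ X))) t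
    ≡⟨ cong₂ (λ c c′ → F- c (F- c′ (F- a₁ (F- a₃ X))) t) a₄+a₄≡c₂ a₂+a₂≡c₁ ⟩
  F- c₂ (F- c₁ (F- a₁ (F- a₃ X))) t
    ≡⟨ Linear.cong-≗ (factor-linear -1ℤ c₂) (Linear.cong-≗ (factor-linear -1ℤ c₁)
         (λ u → sym (trans (prod-factor (quarticFactors 0 (n * 2)) -1ℤ a₁ _ u)
                           (Linear.cong-≗ (factor-linear -1ℤ a₁)
                              (prod-factor (quarticFactors 0 (n * 2)) -1ℤ a₃ _) u)))) t ⟩
  F- c₂ (F- c₁ (Quartic (F- a₁ (F- a₃ (Odd f))))) t ∎
  where
  open ≡-Reasoning
  F- F+ : ℕ → Series → Series
  F- = factor -1ℤ
  F+ = factor 1ℤ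
  Euler    = prod (eulerFactors (n * 4))
  Distinct = prod (distinctFactors 2 (n * 2))
  Quartic  = prod (quarticFactors 0 (n * 2))
  Odd      = prod (oddFactors n)
  X = Quartic (Odd f)
  a₁ = suc (n * 4)
  a₂ = suc a₁
  a₃ = suc a₂
  a₄ = suc a₃
  b₁ = suc (n * 2) * 2
  b₂ = suc (suc (n * 2)) * 2
  c₁ = suc (n * 2) * 4
  c₂ = suc (suc (n * 2)) * 4
  F+b₁ = Linear.cong-≗ (factor-linear 1ℤ b₁)
  F+b₂ = Linear.cong-≗ (factor-linear 1ℤ b₂)
  inner : ∀ {g h} → g ≗ h →
          F- a₄ (F- a₃ (F- a₂ (F- a₁ g))) t ≡ F- a₄ (F- a₃ (F- a₂ (F- a₁ h))) t
  inner eq = Linear.cong-≗ (prod-linear ((-1ℤ , a₄) ∷ (-1ℤ , a₃) ∷ (-1ℤ , a₂) ∷ (-1ℤ , a₁) ∷ [])) eq t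
  b₁≡a₂ : b₁ ≡ a₂
  b₁≡a₂ = ring n
    where
    ring : ∀ n → suc (n * 2) * 2 ≡ suc (suc (n * 4))
    ring = ℕSolver.solve-∀
  b₂≡a₄ : b₂ ≡ a₄
  b₂≡a₄ = cong (suc ∘ suc) b₁≡a₂
  a₂+a₂≡c₁ : a₂ + a₂ ≡ c₁
  a₂+a₂≡c₁ = ring n
    where
    ring : ∀ n → suc (suc (n * 4)) + suc (suc (n * 4)) ≡ suc (n * 2) * 4
    ring = ℕSolver.solve-∀
  a₄+a₄≡c₂ : a₄ + a₄ ≡ c₂
  a₄+a₄≡c₂ = ring n
    where
    ring : ∀ n → suc (suc (suc (suc (n * 4)))) + suc (suc (suc (suc (n * 4)))) ≡ suc (suc (n * 2)) * 4
    ring = ℕSolver.solve-∀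

gauss-numerator : ∀ m r →
  prod (quarticFactors 0 r) (gauss 4 m (suc r)) ≗ prod (gaussNumerator m r) 𝟙
gauss-numerator m zero    = gauss-one 4 m
gauss-numerator m (suc r) t = begin
  factor -1ℤ (suc r * 4) (Quartic (gauss 4 m (suc (suc r)))) t
    ≡⟨ sym (prod-factor (quarticFactors 0 r) -1ℤ (suc r * 4) _ t) ⟩
  Quartic (factor -1ℤ (suc r * 4) (gauss 4 m (suc (suc r)))) t
    ≡⟨ Linear.cong-≗ (prod-linear (quarticFactors 0 r)) (gauss-ratio 4 m (suc r)) t ⟩
  Quartic (factor -1ℤ ((m ∸ r) * 4) (gauss 4 m (suc r))) t
    ≡⟨ prod-factor (quarticFactors 0 r) -1ℤ ((m ∸ r) * 4) _ t ⟩
  factor -1ℤ ((m ∸ r) * 4) (Quartic (gauss 4 m (suc r))) t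
    ≡⟨ Linear.cong-≗ (factor-linear -1ℤ ((m ∸ r) * 4)) (gauss-numerator m r) t ⟩
  factor -1ℤ ((m ∸ r) * 4) (prod (gaussNumerator m r) 𝟙) t ∎
  where
  open ≡-Reasoning
  Quartic = prod (quarticFactors 0 r)

quarticFactors-++ : ∀ d i → quarticFactors 0 (d + i) ≡ quarticFactors i d ++ quarticFactors 0 i
quarticFactors-++ zero    i = refl
quarticFactors-++ (suc d) i =
  cong₂ (λ e L → (-1ℤ , e * 4) ∷ L) (trans (cong suc (ℕP.+-comm d i)) (sym (ℕP.+-suc i d)))
        (quarticFactors-++ d i)

quarticFactors-large : ∀ {N} i d → N < suc i * 4 → AllExponents (N <_) (quarticFactors i d)
quarticFactors-large i zero    N<4i+4 = []
quarticFactors-large i (suc d) N<4i+4 =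
  ≤-trans N<4i+4 (ℕP.*-monoˡ-≤ 4 (subst (suc i ≤_) (sym (ℕP.+-suc i d)) (s≤s (ℕP.m≤m+n i d))))
  ∷ quarticFactors-large i d N<4i+4

gaussNumerator-large : ∀ {N} m r → N < (suc m ∸ r) * 4 → AllExponents (N <_) (gaussNumerator m r)
gaussNumerator-large m zero    _  = []
gaussNumerator-large m (suc r) lt =
  lt ∷ gaussNumerator-large m r (≤-trans lt (ℕP.*-monoˡ-≤ 4 (ℕP.∸-monoˡ-≤ r (n≤1+n m))))

-- (q;q)_m [m choose r] = (q^(r+1);q)_(m-r) (q^(m-r+1);q)_r, and both factors are 1 below X^(N+1).
gauss-stable : ∀ {N} m r → r ≤ m → N < suc r * 4 → N < (suc m ∸ r) * 4 →
               prod (quarticFactors 0 m) (gauss 4 m (suc r)) ≈[ N ] 𝟙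
gauss-stable m r r≤m N<4r+4 N<4m-4r+4 =
  ≈-trans (≗⇒≈ split)
    (≈-trans (prod-≈-id (quarticFactors r (m ∸ r)) _ (quarticFactors-large r (m ∸ r) N<4r+4))
      (≈-trans (≗⇒≈ (gauss-numerator m r))
               (prod-≈-id (gaussNumerator m r) 𝟙 (gaussNumerator-large m r N<4m-4r+4))))
  where
  split : prod (quarticFactors 0 m) (gauss 4 m (suc r))
          ≗ prod (quarticFactors r (m ∸ r)) (prod (quarticFactors 0 r) (gauss 4 m (suc r)))
  split t = cong (λ f → f t)
    (trans (cong (λ L → prod L (gauss 4 m (suc r)))
             (trans (cong (quarticFactors 0) (sym (m∸n+n≡m r≤m))) (quarticFactors-++ (m ∸ r) r)))
           (prod-++ (quarticFactors r (m ∸ r)) (quarticFactors 0 r) (gauss 4 m (suc r))))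

ψ : ℕ → Series
ψ K = ∑ˢ[ j < K ] monomial (sign j) (triangular j) 𝟙

triangular-≥ : ∀ j → j ≤ triangular j
triangular-≥ zero    = z≤n
triangular-≥ (suc j) = m≤n+m (suc j) (triangular j)

jacobiIndex-≥ˡ : ∀ r h → r ∸ h ≤ jacobiIndex r h
jacobiIndex-≥ˡ zero    zero    = z≤n
jacobiIndex-≥ˡ zero    (suc h) = z≤n
jacobiIndex-≥ˡ (suc r) zero    = ℕP.m≤m*n (suc r) 2
jacobiIndex-≥ˡ (suc r) (suc h) = jacobiIndex-≥ˡ r h

jacobiIndex-≥ʳ : ∀ r h → h ∸ r ≤ jacobiIndex r h
jacobiIndex-≥ʳ zero    zero    = z≤n
jacobiIndex-≥ʳ zero    (suc h) = s≤s (ℕP.m≤m*n h 2)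
jacobiIndex-≥ʳ (suc r) zero    = z≤n
jacobiIndex-≥ʳ (suc r) (suc h) = jacobiIndex-≥ʳ r h

-- The terms of jacobiSumEven (2N + 1) that reach X^N satisfy the hypotheses of gauss-stable.
jacobiExp-small : ∀ N r → jacobiExp r (suc (N * 2)) ≤ N →
                  N < suc r * 4 × N < (suc (suc (N * 2) * 2) ∸ r) * 4
jacobiExp-small N r small =
  ≤-trans N<r (≤-trans (n≤1+n r) (ℕP.m≤m*n (suc r) 4)) ,
  ≤-trans (ℕP.m+n≤o⇒m≤o∸n (suc N) (subst (_≤ suc (n * 2)) (+-comm r (suc N)) r+N<2n+1))
          (ℕP.m≤m*n _ 4)
  where
  open ℕP.≤-Reasoning
  n = suc (N * 2)
  index-small : jacobiIndex r n ≤ N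
  index-small = ≤-trans (triangular-≥ _) small
  N<r : N < r
  N<r = ℕP.+-cancelʳ-≤ N (suc N) r (begin
    suc N + N    ≡⟨ ring N ⟩
    n            ≤⟨ ℕP.m≤n+m∸n n r ⟩
    r + (n ∸ r)  ≤⟨ ℕP.+-monoʳ-≤ r (≤-trans (jacobiIndex-≥ʳ r n) index-small) ⟩
    r + N        ∎)
    where
    ring : ∀ N → suc N + N ≡ suc (N * 2)
    ring = ℕSolver.solve-∀
  r+N<2n+1 : r + suc N ≤ suc (n * 2)
  r+N<2n+1 = begin
    r + suc N            ≤⟨ ℕP.+-monoˡ-≤ (suc N) (ℕP.m≤n+m∸n r n) ⟩
    n + (r ∸ n) + suc N
      ≤⟨ ℕP.+-monoˡ-≤ (suc N) (ℕP.+-monoʳ-≤ n (≤-trans (jacobiIndex-≥ˡ r n) index-small)) ⟩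
    n + N + suc N        ≤⟨ n≤1+n _ ⟩
    suc (n + N + suc N)  ≡⟨ ring N ⟩
    suc (n * 2)          ∎
    where
    ring : ∀ N → suc (suc (N * 2) + N + suc N) ≡ suc (suc (N * 2) * 2)
    ring = ℕSolver.solve-∀

jacobiIndex-diag : ∀ n k → jacobiIndex (n + k) n ≡ k * 2
jacobiIndex-diag zero    zero    = refl
jacobiIndex-diag zero    (suc k) = refl
jacobiIndex-diag (suc n) k       = jacobiIndex-diag n k

-- r ↦ jacobiIndex r n permutes {0, …, 2n}.
∑-jacobiIndex : ∀ (g : ℕ → ℤ) n →
                ∑[ r < suc (n * 2) ] g (jacobiIndex r n) ≡ ∑[ j < suc (n * 2) ] g j
∑-jacobiIndex g zero    = refl
∑-jacobiIndex g (suc n) = begin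
  ∑[ r < suc K ] F r +ᶻ F (suc K)
    ≡⟨ cong₂ _+ᶻ_ (∑-sucˡ K F) (cong g last) ⟩
  g K +ᶻ ∑[ r < K ] g (jacobiIndex r n) +ᶻ g (suc K)
    ≡⟨ cong (λ z → g K +ᶻ z +ᶻ g (suc K)) (∑-jacobiIndex g n) ⟩
  g K +ᶻ ∑[ j < K ] g j +ᶻ g (suc K)
    ≡⟨ cong (_+ᶻ g (suc K)) (ℤP.+-comm (g K) _) ⟩
  ∑[ j < K ] g j +ᶻ g K +ᶻ g (suc K) ∎
  where
  open ≡-Reasoning
  K = suc (n * 2)
  F : ℕ → ℤ
  F r = g (jacobiIndex r (suc n))
  last : jacobiIndex K n ≡ suc K
  last = trans (cong (λ z → jacobiIndex z n) (ring n)) (jacobiIndex-diag n (suc n))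
    where
    ring : ∀ n → suc (n * 2) ≡ n + suc n
    ring = ℕSolver.solve-∀

eulerFactors-positive : ∀ L → AllExponents (1 ≤_) (eulerFactors L)
eulerFactors-positive zero    = []
eulerFactors-positive (suc L) = s≤s z≤n ∷ eulerFactors-positive L

distinct≈ψ/euler : ∀ N G → prod (eulerFactors (suc (N * 2) * 4)) G ≗ ψ (suc (suc (N * 2) * 2)) →
                   prod (distinctFactors 2 (suc (N * 2) * 2)) 𝟙 ≈[ N ] G
distinct≈ψ/euler N G euler·G≗ψ =
  prod-cancel (eulerFactors (n * 4)) (eulerFactors-positive (n * 4)) (λ t t≤N → begin
    prod (eulerFactors (n * 4)) (prod (distinctFactors 2 (n * 2)) 𝟙) t
      ≡⟨ euler-distinct n 𝟙 t ⟩
    Quartic (prod (oddFactors n) 𝟙) t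
      ≡⟨ Linear.cong-≗ (prod-linear (quarticFactors 0 (n * 2))) (sym ∘ finite-jacobi n) t ⟩
    Quartic (jacobiSumEven n) t
      ≡⟨ Linear.∑-homo (prod-linear (quarticFactors 0 (n * 2))) K _ t ⟩
    ∑[ r < K ] Quartic (jacobiTerm r n (gauss 4 (n * 2) (suc r))) t
      ≡⟨ ∑-cong K (λ r _ → sym (prod-commute (jacobiTerm-linear r n)
            (monomial-shiftInvariant (jacobiSign r n) (jacobiExp r n)) (quarticFactors 0 (n * 2)) _ t)) ⟩
    ∑[ r < K ] jacobiTerm r n (Quartic (gauss 4 (n * 2) (suc r))) t
      ≡⟨ ∑ˢ-≈ K stable t t≤N ⟩
    ∑[ r < K ] jacobiTerm r n 𝟙 t
      ≡⟨ ∑-jacobiIndex (λ j → monomial (sign j) (triangular j) 𝟙 t) n ⟩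
    ψ K t
      ≡⟨ sym (euler·G≗ψ t) ⟩
    prod (eulerFactors (n * 4)) G t ∎)
  where
  open ≡-Reasoning
  n = suc (N * 2)
  K = suc (n * 2)
  Quartic = prod (quarticFactors 0 (n * 2))
  stable : ∀ r → r < K →
           jacobiTerm r n (Quartic (gauss 4 (n * 2) (suc r))) ≈[ N ] jacobiTerm r n 𝟙
  stable r r<K with jacobiExp r n ℕ.≤? N
  ... | yes small = monomial-≈ (jacobiSign r n) (jacobiExp r n)
                      (gauss-stable (n * 2) r (ℕP.≤-pred r<K) (proj₁ bounds) (proj₂ bounds))
    where bounds = jacobiExp-small N r small
  ... | no large  = λ t t≤N → cong (jacobiSign r n *ᶻ_)
                      (trans (shift-below (jacobiExp r n) _ (below t≤N))
                             (sym (shift-below (jacobiExp r n) 𝟙 (below t≤N))))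
    where
    below : ∀ {t} → t ≤ N → t < jacobiExp r n
    below t≤N = ℕP.≤-<-trans t≤N (≰⇒> large)

-- Partitions

¬T⇒≡false : ∀ {b} → ¬ T b → b ≡ false
¬T⇒≡false {false} _  = refl
¬T⇒≡false {true}  ¬t = ⊥-elim (¬t _)

T⇒≡true : ∀ {b} → T b → b ≡ true
T⇒≡true = Equivalence.to T-≡

≢⇒≡ᵇ-false : ∀ {m n} → m ≢ n → (m ≡ᵇ n) ≡ false
≢⇒≡ᵇ-false {m} {n} m≢n = ¬T⇒≡false (m≢n ∘ ℕP.≡ᵇ⇒≡ m n)

partsFuel-zero : ∀ f m → partsFuel f 0 m ≡ [] ∷ []
partsFuel-zero zero    zero    = refl
partsFuel-zero zero    (suc m) = refl
partsFuel-zero (suc f) zero    = refl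
partsFuel-zero (suc f) (suc m) = cong (_++ []) (partsFuel-zero (suc f) m)

partsFuel-suc : ∀ f m n → n ≤ f → partsFuel (suc f) n m ≡ partsFuel f n m
partsFuel-suc zero    zero    n       _   = refl
partsFuel-suc zero    (suc m) zero    _   = cong (_++ []) (partsFuel-zero 1 m)
partsFuel-suc (suc f) zero    n       _   = refl
partsFuel-suc (suc f) (suc m) n       n≤f =
  cong₂ _++_ (partsFuel-suc (suc f) m n n≤f)
             (cong (λ L → if suc m ≤ᵇ n then map (suc m ∷_) L else [])
                   (partsFuel-suc f (suc m) (n ∸ suc m)
                                  (≤-trans (ℕP.∸-monoʳ-≤ n (s≤s z≤n)) (ℕP.∸-monoˡ-≤ 1 n≤f))))

partsFuel-enough : ∀ f n m → n ≤ f → partsFuel f n m ≡ partsFuel n n m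
partsFuel-enough f n m n≤f =
  trans (cong (λ g → partsFuel g n m) (sym (m∸n+n≡m n≤f))) (extra (f ∸ n))
  where
  extra : ∀ d → partsFuel (d + n) n m ≡ partsFuel n n m
  extra zero    = refl
  extra (suc d) = trans (partsFuel-suc (d + n) m n (m≤n+m n d)) (extra d)

boundedPartitions : ℕ → ℕ → List (List ℕ)
boundedPartitions n m = partsFuel n n m

boundedPartitions-suc : ∀ n m → boundedPartitions n (suc m) ≡ boundedPartitions n m ++
  (if suc m ≤ᵇ n then map (suc m ∷_) (boundedPartitions (n ∸ suc m) (suc m)) else [])
boundedPartitions-suc zero    m =
  trans (partsFuel-zero 0 (suc m)) (sym (cong (_++ []) (partsFuel-zero 0 m)))
boundedPartitions-suc (suc n) m =
  cong (λ L → boundedPartitions (suc n) m ++ (if suc m ≤ᵇ suc n then map (suc m ∷_) L else []))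
       (partsFuel-enough n (n ∸ m) (suc m) (ℕP.m∸n≤m n m))

boundedPartitions-stable : ∀ n m → n ≤ m → boundedPartitions n (suc m) ≡ boundedPartitions n m
boundedPartitions-stable n m n≤m
  rewrite boundedPartitions-suc n m | ¬T⇒≡false (λ m<n → ℕP.<⇒≱ (ℕP.≤ᵇ⇒≤ (suc m) n m<n) n≤m)
  = ++-identityʳ (boundedPartitions n m)

boundedPartitions-partitions : ∀ n m → n ≤ m → boundedPartitions n m ≡ partitions n
boundedPartitions-partitions n m n≤m =
  trans (cong (boundedPartitions n) (sym (m∸n+n≡m n≤m))) (go (m ∸ n))
  where
  go : ∀ d → boundedPartitions n (d + n) ≡ partitions n
  go zero    = refl
  go (suc d) = trans (boundedPartitions-stable n (d + n) (m≤n+m n d)) (go d)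

PartsAtMost : ℕ → List ℕ → Set
PartsAtMost m = All (_≤ m)

onlyEmpty-atMost : ∀ {m} n → All (PartsAtMost m) (if n ≡ᵇ 0 then [] ∷ [] else [])
onlyEmpty-atMost n with n ≡ᵇ 0
... | true  = [] ∷ []
... | false = []

partsFuel-atMost : ∀ f n m → All (PartsAtMost m) (partsFuel f n m)
partsFuel-atMost zero    n zero    = onlyEmpty-atMost n
partsFuel-atMost zero    n (suc m) = onlyEmpty-atMost n
partsFuel-atMost (suc f) n zero    = onlyEmpty-atMost n
partsFuel-atMost (suc f) n (suc m) =
  All.++⁺ (All.map (All.map (λ p≤m → ≤-trans p≤m (n≤1+n m))) (partsFuel-atMost (suc f) n m)) withLargest
  where
  withLargest : All (PartsAtMost (suc m))
                    (if suc m ≤ᵇ n then map (suc m ∷_) (partsFuel f (n ∸ suc m) (suc m)) else [])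
  withLargest with suc m ≤ᵇ n
  ... | true  = All.map⁺ (All.map (≤-refl ∷_) (partsFuel-atMost f (n ∸ suc m) (suc m)))
  ... | false = []

count-++ : ∀ (P : List ℕ → Bool) xs ys → count P (xs ++ ys) ≡ count P xs + count P ys
count-++ P []       ys = refl
count-++ P (x ∷ xs) ys with P x
... | true  = cong suc (count-++ P xs ys)
... | false = count-++ P xs ys

count-map : ∀ (P : List ℕ → Bool) g xs → count P (map g xs) ≡ count (P ∘ g) xs
count-map P g []       = refl
count-map P g (x ∷ xs) with P (g x)
... | true  = cong suc (count-map P g xs)
... | false = count-map P g xs

count-cong : ∀ {P Q : List ℕ → Bool} xs → All (λ x → P x ≡ Q x) xs → count P xs ≡ count Q xs
count-cong         []       []       = refl
count-cong {Q = Q} (x ∷ xs) (e ∷ es) rewrite e =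
  cong (λ z → if Q x then suc z else z) (count-cong xs es)

count-none : ∀ {P : List ℕ → Bool} xs → All (λ x → P x ≡ false) xs → count P xs ≡ 0
count-none []       []       = refl
count-none (x ∷ xs) (e ∷ es) rewrite e = count-none xs es

count-boundedPartitions-suc : ∀ (P : List ℕ → Bool) n m →
  count P (boundedPartitions n (suc m)) ≡ count P (boundedPartitions n m) +
    (if suc m ≤ᵇ n then count (P ∘ (suc m ∷_)) (boundedPartitions (n ∸ suc m) (suc m)) else 0)
count-boundedPartitions-suc P n m
  rewrite boundedPartitions-suc n m
        | count-++ P (boundedPartitions n m)
            (if suc m ≤ᵇ n then map (suc m ∷_) (boundedPartitions (n ∸ suc m) (suc m)) else [])
  with suc m ≤ᵇ n
... | true  = cong (λ z → count P (boundedPartitions n m) + z)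
                   (count-map P (suc m ∷_) (boundedPartitions (n ∸ suc m) (suc m)))
... | false = refl

partitionGF : (List ℕ → Bool) → ℕ → Series
partitionGF P m n = + count P (boundedPartitions n m)

-- Split off the partitions containing the part m + 1 and remove one copy of it.
partitionGF-suc : ∀ P m →
  partitionGF P (suc m) ≗ partitionGF P m ⊕ shift (suc m) (partitionGF (P ∘ (suc m ∷_)) (suc m))
partitionGF-suc P m n
  rewrite count-boundedPartitions-suc P n m
        | shift-if (suc m) (partitionGF (P ∘ (suc m ∷_)) (suc m)) n
  with suc m ≤ᵇ n
... | true  = ℤP.pos-+ (count P (boundedPartitions n m)) _
... | false = trans (cong +_ (ℕP.+-identityʳ _)) (sym (ℤP.+-identityʳ _))

partitionsGF : ℕ → Series
partitionsGF = partitionGF (λ _ → true)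

partitionsGF-suc : ∀ m →
  partitionsGF (suc m) ≗ partitionsGF m ⊕ shift (suc m) (partitionsGF (suc m))
partitionsGF-suc = partitionGF-suc (λ _ → true)

containsUpTo : ℕ → List ℕ → Bool
containsUpTo zero    p = true
containsUpTo (suc j) p = containsUpTo j p ∧ elem (suc j) p

containsUpTo-∷ : ∀ j a p → j < a → containsUpTo j (a ∷ p) ≡ containsUpTo j p
containsUpTo-∷ zero    a p _   = refl
containsUpTo-∷ (suc j) a p j<a
  rewrite containsUpTo-∷ j a p (≤-trans (n≤1+n (suc j)) j<a) | ≢⇒≡ᵇ-false (ℕP.<⇒≢ j<a)
  = refl

containsUpTo-∷-self : ∀ m p → containsUpTo (suc m) (suc m ∷ p) ≡ containsUpTo m p
containsUpTo-∷-self m p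
  rewrite containsUpTo-∷ m (suc m) p ≤-refl | T⇒≡true (ℕP.≡⇒≡ᵇ m m refl)
  = ∧-identityʳ (containsUpTo m p)

elem-atMost : ∀ {m k} p → PartsAtMost m p → m < k → elem k p ≡ false
elem-atMost []       []            _   = refl
elem-atMost (x ∷ xs) (x≤m ∷ xs≤m) m<k
  rewrite ≢⇒≡ᵇ-false (ℕP.>⇒≢ (ℕP.≤-<-trans x≤m m<k)) = elem-atMost xs xs≤m m<k

containsUpTo-atMost : ∀ {m} p → PartsAtMost m p → containsUpTo (suc m) p ≡ false
containsUpTo-atMost {m} p p≤m rewrite elem-atMost p p≤m (ℕP.n<1+n m) =
  ∧-zeroʳ (containsUpTo m p)

shift-fixpoint-unique : ∀ a h {f g} → f ≗ h ⊕ shift (suc a) f → g ≗ h ⊕ shift (suc a) g → f ≗ g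
shift-fixpoint-unique a h {f} {g} f-fix g-fix t = go t t ≤-refl
  where
  go : ∀ M t → t ≤ M → f t ≡ g t
  go M       zero    _         = trans (f-fix zero) (sym (g-fix zero))
  go (suc M) (suc t) (s≤s t≤M) =
    trans (f-fix (suc t))
          (trans (cong (h (suc t) +ᶻ_) (shift-≈ a (λ u u≤M → go M u u≤M) t t≤M)) (sym (g-fix (suc t))))

-- Both sides satisfy F = partitionGF (containsUpTo j) m + X^(m+1) F.
containsUpTo-GF-suc : ∀ m j → j ≤ m →
  partitionGF (containsUpTo j) m ≗ shift (triangular j) (partitionsGF m) →
  partitionGF (containsUpTo j) (suc m) ≗ shift (triangular j) (partitionsGF (suc m))
containsUpTo-GF-suc m j j≤m ih = shift-fixpoint-unique m (partitionGF (containsUpTo j) m) lhs-fix rhs-fix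
  where
  lhs-fix : partitionGF (containsUpTo j) (suc m) ≗
            partitionGF (containsUpTo j) m ⊕ shift (suc m) (partitionGF (containsUpTo j) (suc m))
  lhs-fix t = trans (partitionGF-suc (containsUpTo j) m t)
    (cong (partitionGF (containsUpTo j) m t +ᶻ_) (shift-cong (suc m) (λ u →
      cong +_ (count-cong (boundedPartitions u (suc m))
                          (All.universal (λ p → containsUpTo-∷ j (suc m) p (s≤s j≤m)) _))) t))
  rhs-fix : shift (triangular j) (partitionsGF (suc m)) ≗
            partitionGF (containsUpTo j) m ⊕ shift (suc m) (shift (triangular j) (partitionsGF (suc m)))
  rhs-fix t = trans (shift-cong (triangular j) (partitionsGF-suc m) t)
    (trans (Linear.⊕-homo (shift-linear (triangular j)) (partitionsGF m) _ t)
      (cong₂ _+ᶻ_ (sym (ih t)) (shift-shiftInvariant (triangular j) (suc m) _ t)))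

-- Remove one copy of the part m + 1.
containsUpTo-GF-diagonal : ∀ m →
  partitionGF (containsUpTo m) (suc m) ≗ shift (triangular m) (partitionsGF (suc m)) →
  partitionGF (containsUpTo (suc m)) (suc m) ≗ shift (triangular (suc m)) (partitionsGF (suc m))
containsUpTo-GF-diagonal m ih t = begin
  partitionGF (containsUpTo (suc m)) (suc m) t
    ≡⟨ partitionGF-suc (containsUpTo (suc m)) m t ⟩
  partitionGF (containsUpTo (suc m)) m t
    +ᶻ shift (suc m) (partitionGF (containsUpTo (suc m) ∘ (suc m ∷_)) (suc m)) t
    ≡⟨ cong₂ _+ᶻ_ (cong +_ (count-none _ (All.map (λ {p} → containsUpTo-atMost p) (partsFuel-atMost t t m))))
                  (shift-cong (suc m) (λ u → cong +_ (count-cong (boundedPartitions u (suc m))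
                                                        (All.universal (containsUpTo-∷-self m) _))) t) ⟩
  0ℤ +ᶻ shift (suc m) (partitionGF (containsUpTo m) (suc m)) t
    ≡⟨ ℤP.+-identityˡ _ ⟩
  shift (suc m) (partitionGF (containsUpTo m) (suc m)) t
    ≡⟨ shift-cong (suc m) ih t ⟩
  shift (suc m) (shift (triangular m) (partitionsGF (suc m))) t
    ≡⟨ shift-shift (suc m) (triangular m) _ t ⟩
  shift (suc m + triangular m) (partitionsGF (suc m)) t
    ≡⟨ cong (λ e → shift e (partitionsGF (suc m)) t) (+-comm (suc m) (triangular m)) ⟩
  shift (triangular (suc m)) (partitionsGF (suc m)) t ∎
  where open ≡-Reasoning

containsUpTo-GF : ∀ m j → j ≤ m → partitionGF (containsUpTo j) m ≗ shift (triangular j) (partitionsGF m)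
containsUpTo-GF zero    zero _     t = refl
containsUpTo-GF (suc m) j    j≤m+1 with ℕP.m≤n⇒m<n∨m≡n j≤m+1
... | inj₁ (s≤s j≤m) = containsUpTo-GF-suc m j j≤m (containsUpTo-GF m j j≤m)
... | inj₂ refl      =
  containsUpTo-GF-diagonal m (containsUpTo-GF-suc m m ≤-refl (containsUpTo-GF m m ≤-refl))

-- The mex of a partition

mexFrom-≥ : ∀ f k p → k ≤ mexFrom f k p
mexFrom-≥ zero    k p = ≤-refl
mexFrom-≥ (suc f) k p with elem k p
... | true  = ≤-trans (n≤1+n k) (mexFrom-≥ f (suc k) p)
... | false = ≤-refl

mexFrom-elem : ∀ f k p {i} → k ≤ i → i < mexFrom f k p → T (elem i p)
mexFrom-elem zero    k p k≤i i<k = ⊥-elim (ℕP.<-irrefl refl (ℕP.≤-<-trans k≤i i<k))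
mexFrom-elem (suc f) k p {i} k≤i i<mex with elem k p in k∈p
... | false = ⊥-elim (ℕP.<-irrefl refl (ℕP.≤-<-trans k≤i i<mex))
... | true with k ℕ.≟ i
...   | yes refl = subst T (sym k∈p) _
...   | no  k≢i  = mexFrom-elem f (suc k) p (ℕP.≤∧≢⇒< k≤i k≢i) i<mex

mexFrom-∉ : ∀ f k p → mexFrom f k p < f + k → ¬ T (elem (mexFrom f k p) p)
mexFrom-∉ zero    k p k<k = ⊥-elim (ℕP.<-irrefl refl k<k)
mexFrom-∉ (suc f) k p mex<f+k with elem k p in k∈p
... | true  = mexFrom-∉ f (suc k) p (subst (mexFrom f (suc k) p <_) (sym (ℕP.+-suc f k)) mex<f+k)
... | false = subst T k∈p

elem⇒∈ : ∀ {k} p → T (elem k p) → k ∈ p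
elem⇒∈ {k} (x ∷ xs) k∈p with k ≡ᵇ x in k≡x
... | true  = here (ℕP.≡ᵇ⇒≡ k x (subst T (sym k≡x) _))
... | false = there (elem⇒∈ xs k∈p)

-- Pigeonhole on the positions in p of 1, …, length p + 1.
missing-part : ∀ p → ¬ (∀ i → i ≤ length p → T (elem (suc i) p))
missing-part p all-elem =
  let i , j , i<j , same = FinP.pigeonhole (ℕP.n<1+n (length p)) position in
  ℕP.<-irrefl (ℕP.suc-injective (trans (lookup-index (membership i))
                                       (trans (cong (lookup p) same) (sym (lookup-index (membership j))))))
              i<j
  where
  membership : ∀ i → suc (toℕ {suc (length p)} i) ∈ p
  membership i = elem⇒∈ p (all-elem (toℕ i) (ℕP.≤-pred (FinP.toℕ<n i)))
  position : Fin (suc (length p)) → Fin (length p)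
  position i = Any.index (membership i)

mex-positive : ∀ p → 1 ≤ mex p
mex-positive p = mexFrom-≥ (suc (length p)) 1 p

mex-elem : ∀ p {i} → 1 ≤ i → i < mex p → T (elem i p)
mex-elem p = mexFrom-elem (suc (length p)) 1 p

mex-∉ : ∀ p → ¬ T (elem (mex p) p)
mex-∉ p with mex p ℕ.<? suc (length p) + 1
... | yes mex<L+2 = mexFrom-∉ (suc (length p)) 1 p mex<L+2
... | no  mex≮L+2 =
  ⊥-elim (missing-part p (λ i i≤L → mex-elem p (s≤s z≤n) (ℕP.<-≤-trans (s≤s (s≤s i≤L)) L+2≤mex)))
  where
  L+2≤mex : suc (suc (length p)) ≤ mex p
  L+2≤mex = subst (_≤ mex p) (+-comm (suc (length p)) 1) (ℕP.≮⇒≥ mex≮L+2)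

containsUpTo-intro : ∀ j p → (∀ {i} → 1 ≤ i → i ≤ j → T (elem i p)) → containsUpTo j p ≡ true
containsUpTo-intro zero    p _   = refl
containsUpTo-intro (suc j) p all
  rewrite containsUpTo-intro j p (λ 1≤i i≤j → all 1≤i (≤-trans i≤j (n≤1+n j)))
  = T⇒≡true (all (s≤s z≤n) ≤-refl)

containsUpTo-elim : ∀ j p → containsUpTo j p ≡ true → ∀ {i} → 1 ≤ i → i ≤ j → T (elem i p)
containsUpTo-elim zero    p _     (s≤s _) ()
containsUpTo-elim (suc j) p up-to {i} 1≤i i≤j with containsUpTo j p in up-to-j | i ℕ.≟ suc j
... | true | yes refl = subst T (sym up-to) _
... | true | no  i≢j  = containsUpTo-elim j p up-to-j 1≤i (ℕP.≤-pred (ℕP.≤∧≢⇒< i≤j i≢j))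

containsUpTo-below-mex : ∀ p {j} → j < mex p → containsUpTo j p ≡ true
containsUpTo-below-mex p {j} j<mex =
  containsUpTo-intro j p (λ 1≤i i≤j → mex-elem p 1≤i (ℕP.≤-<-trans i≤j j<mex))

containsUpTo-from-mex : ∀ p {j} → mex p ≤ j → containsUpTo j p ≡ false
containsUpTo-from-mex p {j} mex≤j =
  ¬T⇒≡false (λ up-to → mex-∉ p (containsUpTo-elim j p (T⇒≡true up-to) (mex-positive p) mex≤j))

mex-atMost : ∀ {N} p → PartsAtMost N p → mex p ≤ suc N
mex-atMost {N} p p≤N with mex p ℕ.≤? suc N
... | yes mex≤N+1 = mex≤N+1
... | no  mex≰N+1 = ⊥-elim (subst T (elem-atMost p p≤N (ℕP.n<1+n N))
                             (mex-elem p (s≤s z≤n) (≰⇒> mex≰N+1)))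

indicator : Bool → ℤ
indicator true  = 1ℤ
indicator false = 0ℤ

χ₄ : ℕ → ℤ
χ₄ r = indicator (r % 4 ≡ᵇ 1) -ᶻ indicator (r % 4 ≡ᵇ 3)

χ₄-∑sign : ∀ r → χ₄ r ≡ ∑[ j < r ] sign j
χ₄-∑sign zero                      = refl
χ₄-∑sign (suc zero)                = refl
χ₄-∑sign (suc (suc zero))          = refl
χ₄-∑sign (suc (suc (suc zero)))    = refl
χ₄-∑sign (suc (suc (suc (suc r)))) = begin
  χ₄ (4 + r)
    ≡⟨ cong (λ z → indicator (z ≡ᵇ 1) -ᶻ indicator (z ≡ᵇ 3)) period ⟩
  χ₄ r
    ≡⟨ χ₄-∑sign r ⟩
  ∑[ j < r ] sign j
    ≡⟨ ring (∑[ j < r ] sign j) (sign r) (sign (suc r)) ⟩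
  ∑[ j < r ] sign j +ᶻ sign r +ᶻ sign (suc r) +ᶻ -ᶻ sign r +ᶻ -ᶻ sign (suc r) ∎
  where
  open ≡-Reasoning
  period : (4 + r) % 4 ≡ r % 4
  period = trans (cong (_% 4) (+-comm 4 r)) ([m+n]%n≡m%n r 4)
  ring : ∀ s a b → s ≡ s +ᶻ a +ᶻ b +ᶻ -ᶻ a +ᶻ -ᶻ b
  ring = solve-∀

sumList : ∀ {A : Set} → List A → (A → ℤ) → ℤ
sumList []       F = 0ℤ
sumList (x ∷ xs) F = F x +ᶻ sumList xs F

syntax sumList xs (λ x → e) = ∑[ x ∈ xs ] e

∑∈-cong : ∀ {A : Set} {F G : A → ℤ} xs → All (λ x → F x ≡ G x) xs →
          ∑[ x ∈ xs ] F x ≡ ∑[ x ∈ xs ] G x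
∑∈-cong []       []       = refl
∑∈-cong (x ∷ xs) (e ∷ es) = cong₂ _+ᶻ_ e (∑∈-cong xs es)

∑∈-distribˡ-* : ∀ {A : Set} c (F : A → ℤ) xs → ∑[ x ∈ xs ] (c *ᶻ F x) ≡ c *ᶻ ∑[ x ∈ xs ] F x
∑∈-distribˡ-* c F []       = sym (ℤP.*-zeroʳ c)
∑∈-distribˡ-* c F (x ∷ xs) =
  trans (cong (c *ᶻ F x +ᶻ_) (∑∈-distribˡ-* c F xs)) (sym (ℤP.*-distribˡ-+ c (F x) _))

∑∈-∑-comm : ∀ {A : Set} K (F : ℕ → A → ℤ) xs →
            ∑[ x ∈ xs ] ∑[ j < K ] F j x ≡ ∑[ j < K ] ∑[ x ∈ xs ] F j x
∑∈-∑-comm K F []       = sym (zeros K)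
  where
  zeros : ∀ K → ∑[ j < K ] 0ℤ ≡ 0ℤ
  zeros zero    = refl
  zeros (suc K) = cong (_+ᶻ 0ℤ) (zeros K)
∑∈-∑-comm K F (x ∷ xs) =
  trans (cong (∑[ j < K ] F j x +ᶻ_) (∑∈-∑-comm K F xs)) (sym (∑-distrib-+ K (λ j → F j x) _))

count-∷ : ∀ (P : List ℕ → Bool) x xs → + count P (x ∷ xs) ≡ indicator (P x) +ᶻ + count P xs
count-∷ P x xs with P x
... | true  = refl
... | false = sym (ℤP.+-identityˡ _)

count-indicator : ∀ (P : List ℕ → Bool) xs → + count P xs ≡ ∑[ x ∈ xs ] indicator (P x)
count-indicator P []       = refl
count-indicator P (x ∷ xs) =
  trans (count-∷ P x xs) (cong (indicator (P x) +ᶻ_) (count-indicator P xs))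

count-difference : ∀ (P Q : List ℕ → Bool) xs →
  + count P xs -ᶻ + count Q xs ≡ ∑[ x ∈ xs ] (indicator (P x) -ᶻ indicator (Q x))
count-difference P Q []       = refl
count-difference P Q (x ∷ xs) =
  trans (cong₂ _-ᶻ_ (count-∷ P x xs) (count-∷ Q x xs))
        (trans (ring (indicator (P x)) (+ count P xs) (indicator (Q x)) (+ count Q xs))
               (cong (indicator (P x) -ᶻ indicator (Q x) +ᶻ_) (count-difference P Q xs)))
  where
  ring : ∀ a b c d → a +ᶻ b -ᶻ (c +ᶻ d) ≡ a -ᶻ c +ᶻ (b -ᶻ d)
  ring = solve-∀

χ₄-mex : ∀ {N} p → PartsAtMost N p →
         χ₄ (mex p) ≡ ∑[ j < suc N ] (sign j *ᶻ indicator (containsUpTo j p))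
χ₄-mex {N} p p≤N = begin
  χ₄ (mex p)             ≡⟨ χ₄-∑sign (mex p) ⟩
  ∑[ j < mex p ] sign j  ≡⟨ ∑-cong (mex p) (λ j j<mex → sym (below-mex j j<mex)) ⟩
  ∑[ j < mex p ] term j  ≡⟨ sym (∑-truncate term (mex-atMost p p≤N) from-mex) ⟩
  ∑[ j < suc N ] term j  ∎
  where
  open ≡-Reasoning
  term : ℕ → ℤ
  term j = sign j *ᶻ indicator (containsUpTo j p)
  below-mex : ∀ j → j < mex p → term j ≡ sign j
  below-mex j j<mex =
    trans (cong (λ b → sign j *ᶻ indicator b) (containsUpTo-below-mex p j<mex)) (ℤP.*-identityʳ (sign j))
  from-mex : ∀ j → mex p ≤ j → term j ≡ 0ℤ
  from-mex j mex≤j =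
    trans (cong (λ b → sign j *ᶻ indicator b) (containsUpTo-from-mex p mex≤j)) (ℤP.*-zeroʳ (sign j))

o₁-o₃ : ∀ N →
        + o₁ N -ᶻ + o₃ N ≡ ∑[ j < suc N ] (sign j *ᶻ shift (triangular j) (partitionsGF N) N)
o₁-o₃ N = begin
  + o₁ N -ᶻ + o₃ N
    ≡⟨ count-difference _ _ (partitions N) ⟩
  ∑[ p ∈ partitions N ] χ₄ (mex p)
    ≡⟨ ∑∈-cong (partitions N) (All.map (λ {p} → χ₄-mex p) (partsFuel-atMost N N N)) ⟩
  ∑[ p ∈ partitions N ] ∑[ j < suc N ] (sign j *ᶻ indicator (containsUpTo j p))
    ≡⟨ ∑∈-∑-comm (suc N) (λ j p → sign j *ᶻ indicator (containsUpTo j p)) (partitions N) ⟩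
  ∑[ j < suc N ] ∑[ p ∈ partitions N ] (sign j *ᶻ indicator (containsUpTo j p))
    ≡⟨ ∑-cong (suc N) (λ j j≤N → trans (∑∈-distribˡ-* (sign j) _ (partitions N))
         (cong (sign j *ᶻ_) (trans (sym (count-indicator (containsUpTo j) (partitions N)))
                                   (containsUpTo-GF N j (ℕP.≤-pred j≤N) N)))) ⟩
  ∑[ j < suc N ] (sign j *ᶻ shift (triangular j) (partitionsGF N) N) ∎
  where open ≡-Reasoning

-- Generating functions of o₁ - o₃ and of partitions into distinct parts

euler-partitionsGF : ∀ L → prod (eulerFactors L) (partitionsGF L) ≗ 𝟙
euler-partitionsGF zero    zero    = refl
euler-partitionsGF zero    (suc t) = refl
euler-partitionsGF (suc L) t =
  trans (sym (prod-factor (eulerFactors L) -1ℤ (suc L) (partitionsGF (suc L)) t))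
        (trans (Linear.cong-≗ (prod-linear (eulerFactors L)) divide t) (euler-partitionsGF L t))
  where
  divide : factor -1ℤ (suc L) (partitionsGF (suc L)) ≗ partitionsGF L
  divide u = rearrange (partitionsGF-suc L u)
    where
    rearrange : partitionsGF (suc L) u ≡ partitionsGF L u +ᶻ shift (suc L) (partitionsGF (suc L)) u →
                factor -1ℤ (suc L) (partitionsGF (suc L)) u ≡ partitionsGF L u
    rearrange eq rewrite eq = ring (partitionsGF L u) (shift (suc L) (partitionsGF (suc L)) u)
      where
      ring : ∀ y z → y +ᶻ z +ᶻ -1ℤ *ᶻ z ≡ y
      ring = solve-∀

partitionsGF-stable : ∀ {N L t} → N ≤ L → t ≤ N → partitionsGF L t ≡ partitionsGF N t
partitionsGF-stable {N} {L} {t} N≤L t≤N =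
  cong (λ ps → + count (λ _ → true) ps)
       (trans (boundedPartitions-partitions t L (≤-trans t≤N N≤L))
              (sym (boundedPartitions-partitions t N t≤N)))

ψ·partitionsGF : ℕ → ℕ → Series
ψ·partitionsGF L K = ∑ˢ[ j < K ] monomial (sign j) (triangular j) (partitionsGF L)

euler-ψ·partitionsGF : ∀ L K → prod (eulerFactors L) (ψ·partitionsGF L K) ≗ ψ K
euler-ψ·partitionsGF L K t =
  trans (Linear.∑-homo (prod-linear (eulerFactors L)) K _ t) (∑-cong K (λ j _ → term j))
  where
  term : ∀ j → prod (eulerFactors L) (monomial (sign j) (triangular j) (partitionsGF L)) t
               ≡ monomial (sign j) (triangular j) 𝟙 t
  term j = trans (sym (prod-commute (monomial-linear (sign j) (triangular j))
                                    (monomial-shiftInvariant (sign j) (triangular j))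
                                    (eulerFactors L) (partitionsGF L) t))
                 (Linear.cong-≗ (monomial-linear (sign j) (triangular j)) (euler-partitionsGF L) t)

ψ·partitionsGF-o₁-o₃ : ∀ {N L K} → N ≤ L → N < K → ψ·partitionsGF L K N ≡ + o₁ N -ᶻ + o₃ N
ψ·partitionsGF-o₁-o₃ {N} {L} {K} N≤L N<K = begin
  ∑[ j < K ] term L j
    ≡⟨ ∑-truncate (term L) N<K beyond ⟩
  ∑[ j < suc N ] term L j
    ≡⟨ ∑-cong (suc N) (λ j _ → cong (sign j *ᶻ_)
          (shift-≈ (triangular j) (λ u u≤N → partitionsGF-stable N≤L u≤N) N ≤-refl)) ⟩
  ∑[ j < suc N ] term N j
    ≡⟨ sym (o₁-o₃ N) ⟩
  + o₁ N -ᶻ + o₃ N ∎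
  where
  open ≡-Reasoning
  term : ℕ → ℕ → ℤ
  term L j = sign j *ᶻ shift (triangular j) (partitionsGF L) N
  beyond : ∀ j → N < j → term L j ≡ 0ℤ
  beyond j N<j = trans (cong (sign j *ᶻ_) (shift-below (triangular j) (partitionsGF L)
                                             (ℕP.<-≤-trans N<j (triangular-≥ j))))
                       (ℤP.*-zeroʳ (sign j))

distinct-∷ : ∀ {L} p → PartsAtMost L p → distinct (suc L ∷ p) ≡ distinct p
distinct-∷ []       _            = refl
distinct-∷ (y ∷ ys) (y≤L ∷ _) rewrite T⇒≡true (ℕP.<⇒<ᵇ (s≤s y≤L)) = refl

distinctGF : ℕ → Series
distinctGF = partitionGF distinct

distinctGF-suc : ∀ L → distinctGF (suc L) ≗ distinctGF L ⊕ shift (suc L) (distinctGF L)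
distinctGF-suc L t =
  trans (partitionGF-suc distinct L t) (cong (distinctGF L t +ᶻ_) (shift-cong (suc L) withLargest t))
  where
  repeated : ∀ q → distinct (suc L ∷ suc L ∷ q) ≡ false
  repeated q rewrite ¬T⇒≡false (λ lt → ℕP.<-irrefl refl (ℕP.<ᵇ⇒< (suc L) (suc L) lt)) = refl
  withLargest : partitionGF (distinct ∘ (suc L ∷_)) (suc L) ≗ distinctGF L
  withLargest u = begin
    partitionGF (distinct ∘ (suc L ∷_)) (suc L) u
      ≡⟨ partitionGF-suc (distinct ∘ (suc L ∷_)) L u ⟩
    partitionGF (distinct ∘ (suc L ∷_)) L u
      +ᶻ shift (suc L) (partitionGF (distinct ∘ (suc L ∷_) ∘ (suc L ∷_)) (suc L)) u
      ≡⟨ cong₂ _+ᶻ_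
           (cong +_ (count-cong (boundedPartitions u L) (All.map (λ {p} → distinct-∷ p) (partsFuel-atMost u u L))))
           (Linear.vanishing (shift-linear (suc L))
              (λ v → cong +_ (count-none (boundedPartitions v (suc L)) (All.universal repeated _))) u) ⟩
    distinctGF L u +ᶻ 0ℤ
      ≡⟨ ℤP.+-identityʳ _ ⟩
    distinctGF L u ∎
    where open ≡-Reasoning

distinctFactors-distinctGF : ∀ L → prod (distinctFactors 1 L) 𝟙 ≗ distinctGF L
distinctFactors-distinctGF zero    zero    = refl
distinctFactors-distinctGF zero    (suc t) = refl
distinctFactors-distinctGF (suc L) t = begin
  factor 1ℤ (suc L * 1) (prod (distinctFactors 1 L) 𝟙) t
    ≡⟨ cong (λ e → factor 1ℤ e (prod (distinctFactors 1 L) 𝟙) t) (ℕP.*-identityʳ (suc L)) ⟩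
  factor 1ℤ (suc L) (prod (distinctFactors 1 L) 𝟙) t
    ≡⟨ Linear.cong-≗ (factor-linear 1ℤ (suc L)) (distinctFactors-distinctGF L) t ⟩
  distinctGF L t +ᶻ 1ℤ *ᶻ shift (suc L) (distinctGF L) t
    ≡⟨ cong (distinctGF L t +ᶻ_) (ℤP.*-identityˡ (shift (suc L) (distinctGF L) t)) ⟩
  distinctGF L t +ᶻ shift (suc L) (distinctGF L) t
    ≡⟨ sym (distinctGF-suc L t) ⟩
  distinctGF (suc L) t ∎
  where open ≡-Reasoning

shift-even : ∀ a f t → shift (a * 2) f (t * 2) ≡ shift a (λ u → f (u * 2)) t
shift-even zero    f t       = refl
shift-even (suc a) f zero    = refl
shift-even (suc a) f (suc t) = shift-even a f t

shift-odd : ∀ a f t → shift (a * 2) f (suc (t * 2)) ≡ shift a (λ u → f (suc (u * 2))) t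
shift-odd zero    f t       = refl
shift-odd (suc a) f zero    = refl
shift-odd (suc a) f (suc t) = shift-odd a f t

distinctFactors-even : ∀ L t → prod (distinctFactors 2 L) 𝟙 (t * 2) ≡ prod (distinctFactors 1 L) 𝟙 t
distinctFactors-even zero    zero    = refl
distinctFactors-even zero    (suc t) = refl
distinctFactors-even (suc L) t =
  cong₂ (λ x y → x +ᶻ 1ℤ *ᶻ y) (distinctFactors-even L t)
        (trans (shift-even (suc L) _ t)
               (trans (shift-cong (suc L) (distinctFactors-even L) t)
                      (cong (λ e → shift e (prod (distinctFactors 1 L) 𝟙) t)
                            (sym (ℕP.*-identityʳ (suc L))))))

distinctFactors-q : ∀ {m L} → m ≤ L → prod (distinctFactors 2 L) 𝟙 (m * 2) ≡ + q m
distinctFactors-q {m} {L} m≤L =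
  trans (distinctFactors-even L m)
        (trans (distinctFactors-distinctGF L m)
               (cong (λ ps → + count distinct ps) (boundedPartitions-partitions m L m≤L)))

distinctFactors-odd : ∀ L t → prod (distinctFactors 2 L) 𝟙 (suc (t * 2)) ≡ 0ℤ
distinctFactors-odd zero    t = refl
distinctFactors-odd (suc L) t
  rewrite distinctFactors-odd L t
        | shift-odd (suc L) (prod (distinctFactors 2 L) 𝟙) t
        | Linear.vanishing (shift-linear (suc L)) (distinctFactors-odd L) t = refl

distinctFactors-o₁-o₃ : ∀ N → prod (distinctFactors 2 (suc (N * 2) * 2)) 𝟙 N ≡ + o₁ N -ᶻ + o₃ N
distinctFactors-o₁-o₃ N =
  trans (distinct≈ψ/euler N (ψ·partitionsGF L K) (euler-ψ·partitionsGF L K) N ≤-refl)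
        (ψ·partitionsGF-o₁-o₃ N≤L N<K)
  where
  L = suc (N * 2) * 4
  K = suc (suc (N * 2) * 2)
  N≤2N+1 : N ≤ suc (N * 2)
  N≤2N+1 = ≤-trans (ℕP.m≤m*n N 2) (n≤1+n _)
  N≤L : N ≤ L
  N≤L = ≤-trans N≤2N+1 (ℕP.m≤m*n (suc (N * 2)) 4)
  N<K : N < K
  N<K = s≤s (≤-trans N≤2N+1 (ℕP.m≤m*n (suc (N * 2)) 2))

o₁-o₃-odd : ∀ k → o₁ (suc (k * 2)) ≡ o₃ (suc (k * 2))
o₁-o₃-odd k = ℤP.+-injective (ℤP.i-j≡0⇒i≡j _ _
  (trans (sym (distinctFactors-o₁-o₃ n)) (distinctFactors-odd (suc (n * 2) * 2) k)))
  where n = suc (k * 2)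

o₁-o₃-even : ∀ m → o₁ (m * 2) ≡ o₃ (m * 2) + q m
o₁-o₃-even m = ℤP.+-injective (begin
  + o₁ n                        ≡⟨ ring (+ o₁ n) (+ o₃ n) ⟩
  + o₃ n +ᶻ (+ o₁ n -ᶻ + o₃ n)  ≡⟨ cong (+ o₃ n +ᶻ_) (sym (distinctFactors-o₁-o₃ n)) ⟩
  + o₃ n +ᶻ prod (distinctFactors 2 (suc (n * 2) * 2)) 𝟙 n
                                ≡⟨ cong (+ o₃ n +ᶻ_) (distinctFactors-q m≤L) ⟩
  + o₃ n +ᶻ + q m               ≡⟨ sym (ℤP.pos-+ (o₃ n) (q m)) ⟩
  + (o₃ n + q m)                ∎)
  where
  open ≡-Reasoning
  n = m * 2
  m≤L : m ≤ suc (n * 2) * 2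
  m≤L = ≤-trans (ℕP.m≤m*n m 2)
          (≤-trans (ℕP.m≤m*n n 2) (≤-trans (n≤1+n (n * 2)) (ℕP.m≤m*n (suc (n * 2)) 2)))
  ring : ∀ a b → a ≡ b +ᶻ (a -ᶻ b)
  ring = solve-∀

-- The hypothesis 1 ≤ n is unused: the identity also holds for n = 0.
proposition9 : (n : ℕ) → 1 ≤ n →
    (n % 2 ≡ 1 → o₁ n ≡ o₃ n) × ((m : ℕ) → n ≡ 2 * m → o₁ n ≡ o₃ n + q m)
proposition9 n _ = odd , even
  where
  odd : n % 2 ≡ 1 → o₁ n ≡ o₃ n
  odd n%2≡1 = subst (λ k → o₁ k ≡ o₃ k) (sym n≡2k+1) (o₁-o₃-odd (n / 2))
    where
    n≡2k+1 : n ≡ suc (n / 2 * 2)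
    n≡2k+1 = trans (m≡m%n+[m/n]*n n 2) (cong (_+ n / 2 * 2) n%2≡1)
  even : (m : ℕ) → n ≡ 2 * m → o₁ n ≡ o₃ n + q m
  even m n≡2m = subst (λ k → o₁ k ≡ o₃ k + q m) (sym (trans n≡2m (ℕP.*-comm 2 m))) (o₁-o₃-even m)
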